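{- Let $G$ be a graph with an orientation $\vec G$ and an $\mathbb{S}^2$-flow $\varphi$ on $\vec G$ such that $S_{\mathbb{Q}}(\varphi)$ is odd-coordinate-free and has rank (dimension over $\mathbb{Q}$) at most $2$. Then $G$ admits a $4$-flow.
   Context: Graphs are finite. For an orientation $\vec G$, $E^+(v)$ (resp. $E^-(v)$) denotes the set of edges with tail (resp. head) $v$ and other end different from $v$. An $\mathbb{S}^2$-flow on $\vec G$ is a map $\varphi$ from the edges to unit vectors of $\mathbb{R}^3$ with $\sum_{e\in E^+(v)}\varphi(e)=\sum_{e\in E^-(v)}\varphi(e)$ at every vertex $v$. Let $\{\varphi(e): e\in E(\vec G)\}=\{\mathbf v_1,\dots,\mathbf v_b\}$ (distinct vectors) and $E_i=\{e:\varphi(e)=\mathbf v_i\}$. For a vertex $v$ set $\epsilon_i(v)=|E^+(v)\cap E_i|-|E^-(v)\cap E_i|$ and $\boldsymbol\epsilon(v)=(\epsilon_1(v),\dots,\epsilon_b(v))\in\mathbb{Z}^b$. $S_{\mathbb{Q}}(\varphi)$ is the $\mathbb{Q}$-linear span of $\{\boldsymbol\epsilon(v):v\in V(G)\}$ in $\mathbb{Q}^b$. A subspace of $\mathbb{Q}^b$ is odd-coordinate-free if it contains no integer vector with exactly one odd coordinate. A $4$-flow of $G$ is a map $\psi$ from the edges of some orientation of $G$ to $\mathbb{Z}$ with $0<|\psi(e)|<4$ for all $e$ and $\sum_{e\in E^+(v)}\psi(e)=\sum_{e\in E^-(v)}\psi(e)$ at every vertex. -}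

module Defs where

open import Level using (0ℓ)
open import Data.Bool using (Bool; true; false; if_then_else_)
open import Data.Nat as ℕ using (ℕ; zero; suc)
open import Data.Fin using (Fin; zero; suc; _≟_)
open import Data.Product using (_×_; _,_; proj₁; proj₂; ∃; ∃-syntax; Σ-syntax)
open import Data.Empty using (⊥)
open import Data.Sum using (_⊎_)
open import Relation.Nullary using (¬_; yes; no)
open import Relation.Binary.PropositionalEquality using (_≡_; _≢_)
open import Function.Definitions using (Injective; Surjective)
open import Data.Integer as ℤ using (ℤ)
open import Data.Integer.Divisibility as ℤ∣ using ()
open import Data.Rational as ℚ using (ℚ)

fsum : {A : Set} → (A → A → A) → A → ∀ {m} → (Fin m → A) → A
fsum _∙_ e {zero}  f = e
fsum _∙_ e {suc m} f = f zero ∙ fsum _∙_ e (λ i → f (suc i))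

-- The real numbers, axiomatised as a Dedekind-complete ordered field
-- (any two models are isomorphic, so quantifying over all models is
-- the same as talking about ℝ).

record RealField : Set₁ where
  infixl 6 _+_
  infixl 7 _*_
  infix  4 _≤_
  field
    R    : Set
    _+_  : R → R → R
    _*_  : R → R → R
    -_   : R → R
    0#   : R
    1#   : R
    _≤_  : R → R → Set
    +-assoc  : ∀ x y z → (x + y) + z ≡ x + (y + z)
    +-comm   : ∀ x y → x + y ≡ y + x
    +-idʳ    : ∀ x → x + 0# ≡ x
    +-invʳ   : ∀ x → x + (- x) ≡ 0#
    *-assoc  : ∀ x y z → (x * y) * z ≡ x * (y * z)
    *-comm   : ∀ x y → x * y ≡ y * x
    *-idʳ    : ∀ x → x * 1# ≡ x
    distribˡ : ∀ x y z → x * (y + z) ≡ (x * y) + (x * z)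
    0≢1      : 0# ≢ 1#
    *-inv    : ∀ x → x ≢ 0# → ∃[ y ] (x * y ≡ 1#)
    ≤-refl    : ∀ x → x ≤ x
    ≤-antisym : ∀ {x y} → x ≤ y → y ≤ x → x ≡ y
    ≤-trans   : ∀ {x y z} → x ≤ y → y ≤ z → x ≤ z
    ≤-total   : ∀ x y → (x ≤ y) ⊎ (y ≤ x)
    +-mono-≤  : ∀ {x y} z → x ≤ y → x + z ≤ y + z
    *-nonneg  : ∀ {x y} → 0# ≤ x → 0# ≤ y → 0# ≤ x * y
    complete  : (S : R → Set) → ∃[ x ] S x → ∃[ u ] (∀ x → S x → x ≤ u) →
                ∃[ s ] ((∀ x → S x → x ≤ s) ×
                        (∀ u → (∀ x → S x → x ≤ u) → s ≤ u))

-- Finite graphs (loops and parallel edges allowed): vertices Fin n,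
-- edges Fin m, each edge with its two (unordered) ends.

record Graph : Set where
  field
    n    : ℕ
    m    : ℕ
    ends : Fin m → Fin n × Fin n

-- An orientation chooses, for each edge, which end is the tail.
Orientation : Graph → Set
Orientation G = Fin (Graph.m G) → Bool

module _ (G : Graph) (o : Orientation G) where
  open Graph G

  tail : Fin m → Fin n
  tail e = if o e then proj₁ (ends e) else proj₂ (ends e)

  head : Fin m → Fin n
  head e = if o e then proj₂ (ends e) else proj₁ (ends e)

  -- Sum over E⁺(v) (tail v, other end ≠ v) and E⁻(v) (head v, other end ≠ v)
  sumOut : {A : Set} → (A → A → A) → A → Fin n → (Fin m → A) → A
  sumOut _∙_ e v f = fsum _∙_ e (λ x → case-out x)
    where
    case-out : Fin m → _
    case-out x with tail x ≟ v | head x ≟ v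
    ... | yes _ | no _ = f x
    ... | _     | _    = e

  sumIn : {A : Set} → (A → A → A) → A → Fin n → (Fin m → A) → A
  sumIn _∙_ e v f = fsum _∙_ e (λ x → case-in x)
    where
    case-in : Fin m → _
    case-in x with head x ≟ v | tail x ≟ v
    ... | yes _ | no _ = f x
    ... | _     | _    = e

module _ (ℝ : RealField) where
  open RealField ℝ

  R³ : Set
  R³ = R × R × R

  _+³_ : R³ → R³ → R³
  (a , b , c) +³ (a' , b' , c') = (a + a') , (b + b') , (c + c')

  0³ : R³
  0³ = 0# , 0# , 0#

  IsUnit : R³ → Set
  IsUnit (a , b , c) = (a * a) + (b * b) + (c * c) ≡ 1#

  IsS2Flow : (G : Graph) → Orientation G → (Fin (Graph.m G) → R³) → Set
  IsS2Flow G o φ =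
    (∀ e → IsUnit (φ e)) ×
    (∀ v → sumOut G o _+³_ 0³ v φ ≡ sumIn G o _+³_ 0³ v φ)

  record ValueEnumeration (G : Graph) (φ : Fin (Graph.m G) → R³) : Set where
    field
      b     : ℕ
      val   : Fin b → R³
      cls   : Fin (Graph.m G) → Fin b
      val-injective  : Injective _≡_ _≡_ val
      cls-surjective : ∀ i → ∃[ e ] (cls e ≡ i)
      φ≡val∘cls      : ∀ e → φ e ≡ val (cls e)

module _ (G : Graph) (o : Orientation G) {b : ℕ}
         (cls : Fin (Graph.m G) → Fin b) where
  open Graph G

  indicator : Fin b → Fin m → ℤ
  indicator i e with cls e ≟ i
  ... | yes _ = ℤ.+ 1
  ... | no  _ = ℤ.+ 0

  ε : Fin n → Fin b → ℤ
  ε v i = sumOut G o ℤ._+_ (ℤ.+ 0) v (indicator i)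
          ℤ.- sumIn G o ℤ._+_ (ℤ.+ 0) v (indicator i)

  toℚ : ℤ → ℚ
  toℚ z = z ℚ./ 1

  InS : (Fin b → ℚ) → Set
  InS x = Σ[ q ∈ (Fin n → ℚ) ] (∀ i → x i ≡ fsum ℚ._+_ ℚ.0ℚ (λ v → q v ℚ.* toℚ (ε v i)))

  OneOddCoord : (Fin b → ℤ) → Set
  OneOddCoord z = ∃[ i ] ((¬ (ℤ.+ 2 ℤ∣.∣ z i)) ×
                          (∀ j → j ≢ i → ℤ.+ 2 ℤ∣.∣ z j))

  OddCoordinateFree : Set
  OddCoordinateFree = ∀ (z : Fin b → ℤ) → InS (λ i → toℚ (z i)) → ¬ OneOddCoord z

  RankAtMost2 : Set
  RankAtMost2 = Σ[ u ∈ (Fin b → ℚ) ] Σ[ w ∈ (Fin b → ℚ) ] (∀ (x : Fin b → ℚ) → InS x →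
      Σ[ α ∈ ℚ ] Σ[ β ∈ ℚ ] (∀ i → x i ≡ (α ℚ.* u i) ℚ.+ (β ℚ.* w i)))

Is4Flow : (G : Graph) → Orientation G → (Fin (Graph.m G) → ℤ) → Set
Is4Flow G o ψ =
  (∀ e → (1 ℕ.≤ ℤ.∣ ψ e ∣) × (ℤ.∣ ψ e ∣ ℕ.≤ 3)) ×
  (∀ v → sumOut G o ℤ._+_ (ℤ.+ 0) v ψ ≡ sumIn G o ℤ._+_ (ℤ.+ 0) v ψ)

Admits4Flow : Graph → Set
Admits4Flow G = ∃[ o ] ∃[ ψ ] Is4Flow G o ψ

-- Everything is reduced mod 2. The parity vectors of the integer points of S_ℚ(φ) form a subspace W
-- of F₂^b. It has dimension at most 2: three integer vectors in a rational plane satisfy a nontrivial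
-- integer relation, and after dividing out a power of 2 some coefficient is odd. Odd-coordinate-freeness
-- says that W contains no unit vector. For a spanning pair A, B of W, sort the coordinates i by their
-- column (A i , B i); counting the columns of each kind yields x : Fin b → F₂² ∖ {0} with
-- ∑ A i x i = ∑ B i x i = 0, hence ∑ ε_i(v) x_i = 0 at every vertex v. So the edges of the classes E_i
-- with first (resp. second) coordinate of x_i equal to 1 form an even subgraph, the two even subgraphs
-- cover E(G), Eulerian orientations of them give ±1-flows f₁ and f₂, and f₁ + 2 f₂ is a 4-flow.
-- The 𝕊²-flow enters only through the partition of the edges into the classes E_i.
module Submission where

open import Algebra.Bundles using (CommutativeMonoid)
import Algebra.Properties.CommutativeMonoid.Sum as CommutativeMonoidSum
import Algebra.Properties.Semiring.Sum as SemiringSum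
import Algebra.Solver.Ring.AlmostCommutativeRing as ACR
import Algebra.Solver.Ring.Simple as RingSolver
open import Data.Bool using (if_then_else_)
open import Data.Empty using (⊥-elim)
open import Data.Fin using (Fin; zero; suc; punchIn; _≟_)
open import Data.Fin.Properties using (punchInᵢ≢i)
open import Data.Integer as ℤ using (ℤ; +_; -[1+_]; _⊖_; 0ℤ)
import Data.Integer.Divisibility.Signed as ℤ∣
import Data.Integer.Properties as ℤP
open import Data.Integer.Solver renaming (module +-*-Solver to ℤ-Solver)
open import Data.List using (List; []; _∷_; _++_; length; tabulate)
open import Data.List.Properties using (length-++-sucʳ)
open import Data.List.Relation.Binary.Pointwise as Pointwise using (Pointwise; []; _∷_)
open import Data.Nat as ℕ using (ℕ; zero; suc; _<_)
open import Data.Nat.Divisibility as ℕ∣ using (divides)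
open import Data.Nat.Induction using (<-wellFounded)
import Data.Nat.Properties as ℕP
open import Data.Nat.Solver renaming (module +-*-Solver to ℕ-Solver)
open import Data.Parity.Base as ℙ using (Parity; 0ℙ; 1ℙ; _⁻¹)
import Data.Parity.Properties as ℙP
open import Data.Product using (_×_; _,_; proj₁; proj₂; ∃-syntax; Σ-syntax; swap)
open import Data.Product.Properties using (≡-dec)
open import Data.Rational as ℚ using (ℚ; ↥_; ↧_; 0ℚ; 1ℚ; mkℚ)
import Data.Rational.Properties as ℚP
open import Data.Rational.Solver renaming (module +-*-Solver to ℚ-Solver)
open import Data.Rational.Unnormalised as ℚᵘ using (mkℚᵘ; *≡*)
import Data.Rational.Unnormalised.Properties as ℚᵘP
open import Data.Sign.Base as Sign using (Sign)
open import Data.Sum using (inj₁; inj₂; [_,_]′)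
open import Data.Vec.Functional using (foldr; removeAt; replicate) renaming (_∷_ to _∷ᵥ_)
open import Function using (_∘_)
open import Induction.WellFounded using (Acc; acc)
open import Relation.Binary.Definitions using (DecidableEquality)
open import Relation.Binary.PropositionalEquality
  using (_≡_; _≢_; refl; sym; trans; cong; cong₂; subst; module ≡-Reasoning)
import Relation.Binary.Reasoning.Setoid as SetoidReasoning
open import Relation.Nullary using (¬_; Dec; does; yes; no; _×-dec_)
open import Defs

module ℕΣ = SemiringSum ℕP.+-*-semiring
module ℤΣ = SemiringSum ℤP.+-*-semiring
module ℙΣ = SemiringSum ℙP.+-*-semiring
module ℚΣ = CommutativeMonoidSum ℚP.+-0-commutativeMonoid
module ℙ-Solver = RingSolver (ACR.fromCommutativeRing ℙP.+-*-commutativeRing) ℙP._≟_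

parityℤ : ℤ → Parity
parityℤ i = ℕ.parity ℤ.∣ i ∣

parity-suc-+-suc : ∀ m n → ℕ.parity (suc m) ℙ.+ ℕ.parity (suc n) ≡ ℕ.parity m ℙ.+ ℕ.parity n
parity-suc-+-suc m n = begin
  ℕ.parity (suc m) ℙ.+ ℕ.parity (suc n)  ≡⟨ ℙP.+-homo-+ (suc m) (suc n) ⟨
  ℕ.parity (suc m ℕ.+ suc n)             ≡⟨ cong (ℕ.parity ∘ suc) (ℕP.+-suc m n) ⟩
  ℕ.parity (m ℕ.+ n)                     ≡⟨ ℙP.+-homo-+ m n ⟩
  ℕ.parity m ℙ.+ ℕ.parity n              ∎
  where open ≡-Reasoning

parityℤ-⊖ : ∀ m n → parityℤ (m ⊖ n) ≡ ℕ.parity m ℙ.+ ℕ.parity n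
parityℤ-⊖ zero    zero    = refl
parityℤ-⊖ zero    (suc n) = refl
parityℤ-⊖ (suc m) zero    = sym (ℙP.+-identityʳ _)
parityℤ-⊖ (suc m) (suc n) = begin
  parityℤ (suc m ⊖ suc n)                ≡⟨ cong parityℤ (ℤP.[1+m]⊖[1+n]≡m⊖n m n) ⟩
  parityℤ (m ⊖ n)                        ≡⟨ parityℤ-⊖ m n ⟩
  ℕ.parity m ℙ.+ ℕ.parity n              ≡⟨ parity-suc-+-suc m n ⟨
  ℕ.parity (suc m) ℙ.+ ℕ.parity (suc n)  ∎
  where open ≡-Reasoning

parityℤ-+ : ∀ i j → parityℤ (i ℤ.+ j) ≡ parityℤ i ℙ.+ parityℤ j
parityℤ-+ -[1+ m ] -[1+ n ] = trans (ℙP.+-homo-+ m n) (sym (parity-suc-+-suc m n))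
parityℤ-+ -[1+ m ] (+ n)    = trans (parityℤ-⊖ n (suc m)) (ℙP.+-comm (ℕ.parity n) _)
parityℤ-+ (+ m)    -[1+ n ] = parityℤ-⊖ m (suc n)
parityℤ-+ (+ m)    (+ n)    = ℙP.+-homo-+ m n

parityℤ-* : ∀ i j → parityℤ (i ℤ.* j) ≡ parityℤ i ℙ.* parityℤ j
parityℤ-* i j = trans (cong ℕ.parity (ℤP.abs-* i j)) (ℙP.*-homo-* ℤ.∣ i ∣ ℤ.∣ j ∣)

parityℤ-neg : ∀ i → parityℤ (ℤ.- i) ≡ parityℤ i
parityℤ-neg i = cong ℕ.parity (ℤP.∣-i∣≡∣i∣ i)

parity≡0ℙ⇒2∣ : ∀ n → ℕ.parity n ≡ 0ℙ → 2 ℕ∣.∣ n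
parity≡0ℙ⇒2∣ zero          _    = 2 ℕ∣.∣0
parity≡0ℙ⇒2∣ (suc (suc n)) even = ℕ∣.∣m∣n⇒∣m+n (ℕ∣.∣-refl {2}) (parity≡0ℙ⇒2∣ n even)

2∣⇒parity≡0ℙ : ∀ {n} → 2 ℕ∣.∣ n → ℕ.parity n ≡ 0ℙ
2∣⇒parity≡0ℙ (divides q refl) = trans (ℙP.*-homo-* q 2) (ℙP.*-zeroʳ (ℕ.parity q))

parityℤ≡0ℙ⇒double : ∀ i → parityℤ i ≡ 0ℙ → ∃[ j ] i ≡ j ℤ.* + 2
parityℤ≡0ℙ⇒double i even with ℤ∣.∣ᵤ⇒∣ {+ 2} {i} (parity≡0ℙ⇒2∣ ℤ.∣ i ∣ even)
... | ℤ∣.divides j i≡j*2 = j , i≡j*2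

fsum≡foldr : ∀ {A : Set} (_∙_ : A → A → A) (e : A) {m} (f : Fin m → A) → fsum _∙_ e f ≡ foldr _∙_ e f
fsum≡foldr _∙_ e {zero}  f = refl
fsum≡foldr _∙_ e {suc m} f = cong (f zero ∙_) (fsum≡foldr _∙_ e (f ∘ suc))

foldr-homo : ∀ {A B : Set} {_∙_ : A → A → A} {e : A} {_◦_ : B → B → B} {e′ : B} (h : A → B) →
             (∀ x y → h (x ∙ y) ≡ h x ◦ h y) → h e ≡ e′ →
             ∀ {m} (f : Fin m → A) → h (foldr _∙_ e f) ≡ foldr _◦_ e′ (h ∘ f)
foldr-homo h homo e-homo {zero}  f = e-homo
foldr-homo {_◦_ = _◦_} h homo e-homo {suc m} f =
  trans (homo _ _) (cong (h (f zero) ◦_) (foldr-homo h homo e-homo (f ∘ suc)))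

module _ {a ℓ} (M : CommutativeMonoid a ℓ) where
  open CommutativeMonoid M renaming (_∙_ to _+_; ε to 0#; ∙-congˡ to +-congˡ; identityʳ to +-identityʳ)
  open CommutativeMonoidSum M
  open SetoidReasoning setoid

  sum-δ : ∀ {n} (f : Fin n → Carrier) i → (∀ j → j ≢ i → f j ≈ 0#) → sum f ≈ f i
  sum-δ {suc n} f i vanishes = begin
    sum f                       ≈⟨ sum-remove f ⟩
    f i + sum (removeAt f i)    ≈⟨ +-congˡ (sum-cong-≋ (λ j → vanishes (punchIn i j) (punchInᵢ≢i i j))) ⟩
    f i + sum (replicate n 0#)  ≈⟨ +-congˡ (sum-replicate-zero n) ⟩
    f i + 0#                    ≈⟨ +-identityʳ (f i) ⟩
    f i                         ∎

-- Linear algebra over F₂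

+≡0ℙ⇒≡ : ∀ {p q} → p ℙ.+ q ≡ 0ℙ → p ≡ q
+≡0ℙ⇒≡ {0ℙ} {0ℙ} _ = refl
+≡0ℙ⇒≡ {1ℙ} {1ℙ} _ = refl

_·_ : ∀ {k} → (Fin k → Parity) → (Fin k → Parity) → Parity
x · p = ℙΣ.sum (λ i → x i ℙ.* p i)

Dependent : ∀ {k} (x y z : Fin k → Parity) → Set
Dependent x y z = ∃[ c₁ ] ∃[ c₂ ] ∃[ c₃ ] ¬ (c₁ ≡ 0ℙ × c₂ ≡ 0ℙ × c₃ ≡ 0ℙ) ×
  (∀ i → (c₁ ℙ.* x i) ℙ.+ (c₂ ℙ.* y i) ℙ.+ (c₃ ℙ.* z i) ≡ 0ℙ)

InSpan : ∀ {k} (a b x : Fin k → Parity) → Set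
InSpan a b x = ∃[ c ] ∃[ d ] ∀ i → x i ≡ (c ℙ.* a i) ℙ.+ (d ℙ.* b i)

InSpan-replaceʳ : ∀ {k} {a b x y : Fin k → Parity} c → (∀ i → b i ≡ c ℙ.* a i) → InSpan a b y → InSpan a x y
InSpan-replaceʳ {a = a} {b} {y = y} c b≡ca (c′ , d , y≡) = c′ ℙ.+ (d ℙ.* c) , 0ℙ , λ i → begin
  y i                                    ≡⟨ y≡ i ⟩
  (c′ ℙ.* a i) ℙ.+ (d ℙ.* b i)           ≡⟨ cong (λ t → (c′ ℙ.* a i) ℙ.+ (d ℙ.* t)) (b≡ca i) ⟩
  (c′ ℙ.* a i) ℙ.+ (d ℙ.* (c ℙ.* a i))   ≡⟨ solve 4 (λ c′ d c a → (c′ :* a) :+ (d :* (c :* a)) := ((c′ :+ (d :* c)) :* a) :+ con 0ℙ)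
                                                 refl c′ d c (a i) ⟩
  ((c′ ℙ.+ (d ℙ.* c)) ℙ.* a i) ℙ.+ 0ℙ    ∎
  where open ≡-Reasoning
        open ℙ-Solver

InSpan-replaceˡ : ∀ {k} {a b x y : Fin k → Parity} → (∀ i → a i ≡ 0ℙ) → InSpan a b y → InSpan x b y
InSpan-replaceˡ {a = a} {b} {y = y} a≡0 (c , d , y≡) = 0ℙ , d , λ i → begin
  y i                            ≡⟨ y≡ i ⟩
  (c ℙ.* a i) ℙ.+ (d ℙ.* b i)    ≡⟨ cong (λ t → (c ℙ.* t) ℙ.+ (d ℙ.* b i)) (a≡0 i) ⟩
  (c ℙ.* 0ℙ) ℙ.+ (d ℙ.* b i)     ≡⟨ cong (ℙ._+ (d ℙ.* b i)) (ℙP.*-zeroʳ c) ⟩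
  d ℙ.* b i                      ∎
  where open ≡-Reasoning

module _ {X : Set} {k} (π : X → Fin k → Parity) (S : X → Set) (x₀ : X) (S-x₀ : S x₀)
         (S-dependent : ∀ x y z → S x → S y → S z → Dependent (π x) (π y) (π z)) where

  -- Either f zero is already spanned by a and b, or the relation shows b ∈ span a (resp. a = 0),
  -- and f zero takes the place of b (resp. a).
  spanned-by-two : ∀ {n} (f : Fin n → X) → (∀ v → S (f v)) →
                   ∃[ a ] ∃[ b ] S a × S b × (∀ v → InSpan (π a) (π b) (π (f v)))
  spanned-by-two {zero} f _ = x₀ , x₀ , S-x₀ , S-x₀ , λ ()
  spanned-by-two {suc n} f Sf with spanned-by-two (f ∘ suc) (Sf ∘ suc)
  ... | a , b , Sa , Sb , span with S-dependent (f zero) a b (Sf zero) Sa Sb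
  ... | 1ℙ , c₂ , c₃ , _ , rel = a , b , Sa , Sb , λ where
    zero    → c₂ , c₃ , λ i → +≡0ℙ⇒≡ (trans (sym (ℙP.+-assoc (π (f zero) i) _ _)) (rel i))
    (suc v) → span v
  ... | 0ℙ , c₂ , 1ℙ , _ , rel = a , f zero , Sa , Sf zero , λ where
    zero    → 0ℙ , 1ℙ , λ _ → refl
    (suc v) → InSpan-replaceʳ c₂ (λ i → sym (+≡0ℙ⇒≡ (rel i))) (span v)
  ... | 0ℙ , 1ℙ , 0ℙ , _ , rel = f zero , b , Sf zero , Sb , λ where
    zero    → 1ℙ , 0ℙ , λ i → sym (ℙP.+-identityʳ (π (f zero) i))
    (suc v) → InSpan-replaceˡ (λ i → trans (sym (ℙP.+-identityʳ (π a i))) (rel i)) (span v)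
  ... | 0ℙ , 0ℙ , 0ℙ , c≢0 , _ = ⊥-elim (c≢0 (refl , refl , refl))

InSpan-orthogonal : ∀ {k} {A B X p : Fin k → Parity} → A · p ≡ 0ℙ → B · p ≡ 0ℙ → InSpan A B X → X · p ≡ 0ℙ
InSpan-orthogonal {A = A} {B} {X} {p} A·p≡0 B·p≡0 (c , d , X≡) = begin
  X · p
    ≡⟨ ℙΣ.sum-cong-≗ linear ⟩
  ℙΣ.sum (λ i → (c ℙ.* (A i ℙ.* p i)) ℙ.+ (d ℙ.* (B i ℙ.* p i)))
    ≡⟨ ℙΣ.∑-distrib-+ (λ i → c ℙ.* (A i ℙ.* p i)) (λ i → d ℙ.* (B i ℙ.* p i)) ⟩
  ℙΣ.sum (λ i → c ℙ.* (A i ℙ.* p i)) ℙ.+ ℙΣ.sum (λ i → d ℙ.* (B i ℙ.* p i))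
    ≡⟨ cong₂ ℙ._+_ (ℙΣ.*-distribˡ-sum c (λ i → A i ℙ.* p i)) (ℙΣ.*-distribˡ-sum d (λ i → B i ℙ.* p i)) ⟨
  (c ℙ.* (A · p)) ℙ.+ (d ℙ.* (B · p))
    ≡⟨ cong₂ (λ s t → (c ℙ.* s) ℙ.+ (d ℙ.* t)) A·p≡0 B·p≡0 ⟩
  (c ℙ.* 0ℙ) ℙ.+ (d ℙ.* 0ℙ)
    ≡⟨ cong₂ ℙ._+_ (ℙP.*-zeroʳ c) (ℙP.*-zeroʳ d) ⟩
  0ℙ ∎
  where
  open ≡-Reasoning
  linear : ∀ i → X i ℙ.* p i ≡ (c ℙ.* (A i ℙ.* p i)) ℙ.+ (d ℙ.* (B i ℙ.* p i))
  linear i = trans (cong (ℙ._* p i) (X≡ i))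
    (solve 5 (λ c d a b p → ((c :* a) :+ (d :* b)) :* p := (c :* (a :* p)) :+ (d :* (b :* p))) refl c d (A i) (B i) (p i))
    where open ℙ-Solver

IsUnitVector : ∀ {k} → (Fin k → Parity) → Set
IsUnitVector x = ∃[ i ] x i ≡ 1ℙ × (∀ j → j ≢ i → x j ≡ 0ℙ)

IsUnitVector-resp : ∀ {k} {x y : Fin k → Parity} → (∀ i → x i ≡ y i) → IsUnitVector x → IsUnitVector y
IsUnitVector-resp x≗y (i , xᵢ , others) = i , trans (sym (x≗y i)) xᵢ , λ j j≢i → trans (sym (x≗y j)) (others j j≢i)

toℕ : Parity → ℕ
toℕ 0ℙ = 0
toℕ 1ℙ = 1

weight : ∀ {k} → (Fin k → Parity) → ℕ
weight x = ℕΣ.sum (toℕ ∘ x)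

weight≡0⇒≡0ℙ : ∀ {k} (x : Fin k → Parity) → weight x ≡ 0 → ∀ j → x j ≡ 0ℙ
weight≡0⇒≡0ℙ x w zero    = toℕ≡0⇒≡0ℙ (ℕP.m+n≡0⇒m≡0 (toℕ (x zero)) w)
  where toℕ≡0⇒≡0ℙ : ∀ {p} → toℕ p ≡ 0 → p ≡ 0ℙ
        toℕ≡0⇒≡0ℙ {0ℙ} _ = refl
weight≡0⇒≡0ℙ x w (suc j) = weight≡0⇒≡0ℙ (x ∘ suc) (ℕP.m+n≡0⇒n≡0 (toℕ (x zero)) w) j

weight≡1⇒unit : ∀ {k} (x : Fin k → Parity) → weight x ≡ 1 → IsUnitVector x
weight≡1⇒unit {suc k} x w with x zero in x₀
... | 1ℙ = zero , x₀ , λ where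
  zero    0≢0 → ⊥-elim (0≢0 refl)
  (suc j) _   → weight≡0⇒≡0ℙ (x ∘ suc) (ℕP.suc-injective w) j
... | 0ℙ = let i , xᵢ , others = weight≡1⇒unit (x ∘ suc) w in suc i , xᵢ , λ where
  zero    _   → x₀
  (suc j) j≢i → others j (j≢i ∘ cong suc)

toℕ-split : ∀ {a} b c → toℕ a ≡ toℕ b ℕ.+ toℕ c → a ≡ b ℙ.+ c
toℕ-split {0ℙ} 0ℙ 0ℙ _ = refl
toℕ-split {1ℙ} 0ℙ 1ℙ _ = refl
toℕ-split {1ℙ} 1ℙ 0ℙ _ = refl

weight-split : ∀ {k} {x y z : Fin k → Parity} → (∀ i → toℕ (x i) ≡ toℕ (y i) ℕ.+ toℕ (z i)) →
               weight x ≡ weight y ℕ.+ weight z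
weight-split {y = y} {z} split = trans (ℕΣ.sum-cong-≗ split) (ℕΣ.∑-distrib-+ (toℕ ∘ y) (toℕ ∘ z))

·-split : ∀ {k} {x y z : Fin k → Parity} → (∀ i → toℕ (x i) ≡ toℕ (y i) ℕ.+ toℕ (z i)) →
          ∀ p → x · p ≡ (y · p) ℙ.+ (z · p)
·-split {x = x} {y} {z} split p =
  trans (ℙΣ.sum-cong-≗ distrib) (ℙΣ.∑-distrib-+ (λ i → y i ℙ.* p i) (λ i → z i ℙ.* p i))
  where distrib : ∀ i → x i ℙ.* p i ≡ (y i ℙ.* p i) ℙ.+ (z i ℙ.* p i)
        distrib i = trans (cong (ℙ._* p i) (toℕ-split (y i) (z i) (split i))) (ℙP.*-distribʳ-+ (p i) (y i) (z i))

-- Nowhere-zero F₂²-weights orthogonal to two vectors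

F₂² : Set
F₂² = Parity × Parity

0² : F₂²
0² = 0ℙ , 0ℙ

_+²_ : F₂² → F₂² → F₂²
(p , q) +² (p′ , q′) = p ℙ.+ p′ , q ℙ.+ q′

_·²_ : Parity → F₂² → F₂²
c ·² (p , q) = c ℙ.* p , c ℙ.* q

_≟²_ : DecidableEquality F₂²
_≟²_ = ≡-dec ℙP._≟_ ℙP._≟_

-- Reachable c s holds iff s is a sum of c nonzero vectors of F₂² (every s is, once c ≥ 2).
Reachable : ℕ → F₂² → Set
Reachable c s = (c ≡ 0 → s ≡ 0²) × (c ≡ 1 → s ≢ 0²)

reachable-step : ∀ c s → Reachable (suc c) s → ∃[ x ] x ≢ 0² × Reachable c (s +² x)
reachable-step zero s@(p , q) (_ , s≢0) =
  s , s≢0 refl , (λ _ → cong₂ _,_ (ℙP.p+p≡0ℙ p) (ℙP.p+p≡0ℙ q)) , λ ()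
reachable-step (suc zero) (p , q) _ =
  (p ⁻¹ , 1ℙ) , (λ ()) , (λ ()) , λ _ s+x≡0 → 1ℙ≢0ℙ (trans (sym (ℙP.p+p⁻¹≡1ℙ p)) (cong proj₁ s+x≡0))
  where 1ℙ≢0ℙ : 1ℙ ≢ 0ℙ
        1ℙ≢0ℙ ()
reachable-step (suc (suc c)) s _ = (1ℙ , 1ℙ) , (λ ()) , (λ ()) , λ ()

reachable-0² : ∀ {c} → c ≢ 1 → Reachable c 0²
reachable-0² c≢1 = (λ _ → refl) , λ c≡1 → ⊥-elim (c≢1 c≡1)

reachable-nonzero : ∀ {c s} → c ≢ 0 → s ≢ 0² → Reachable c s
reachable-nonzero c≢0 s≢0 = (λ c≡0 → ⊥-elim (c≢0 c≡0)) , λ _ → s≢0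

reachable-some : ∀ c → ∃[ s ] Reachable c s
reachable-some c with c ℕ.≟ 1
... | yes refl = (1ℙ , 0ℙ) , reachable-nonzero (λ ()) (λ ())
... | no c≢1   = 0² , reachable-0² c≢1

common-target : ∀ a b c → a ℕ.+ c ≢ 1 → b ℕ.+ c ≢ 1 → a ℕ.+ b ≢ 1 →
                ∃[ s ] Reachable a s × Reachable b s × Reachable c s
common-target a b c ac≢1 bc≢1 ab≢1 with a ℕ.≟ 1 | b ℕ.≟ 1 | c ℕ.≟ 1
... | yes refl | _ | _ = (1ℙ , 0ℙ) ,
  reachable-nonzero (λ ()) (λ ()) ,
  reachable-nonzero (λ b≡0 → ab≢1 (cong (1 ℕ.+_) b≡0)) (λ ()) ,
  reachable-nonzero (λ c≡0 → ac≢1 (cong (1 ℕ.+_) c≡0)) (λ ())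
... | no _ | yes refl | _ = (1ℙ , 0ℙ) ,
  reachable-nonzero (λ a≡0 → ab≢1 (cong (ℕ._+ 1) a≡0)) (λ ()) ,
  reachable-nonzero (λ ()) (λ ()) ,
  reachable-nonzero (λ c≡0 → bc≢1 (cong (1 ℕ.+_) c≡0)) (λ ())
... | no _ | no _ | yes refl = (1ℙ , 0ℙ) ,
  reachable-nonzero (λ a≡0 → ac≢1 (cong (ℕ._+ 1) a≡0)) (λ ()) ,
  reachable-nonzero (λ b≡0 → bc≢1 (cong (ℕ._+ 1) b≡0)) (λ ()) ,
  reachable-nonzero (λ ()) (λ ())
... | no a≢1 | no b≢1 | no c≢1 = 0² , reachable-0² a≢1 , reachable-0² b≢1 , reachable-0² c≢1

𝟙 : ∀ {P : Set} → Dec P → Parity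
𝟙 d = if does d then 1ℙ else 0ℙ

module _ {T : Set} (_≟ᵀ_ : DecidableEquality T) where

  colourClass : ∀ {k} → (Fin k → T) → T → Fin k → Parity
  colourClass τ t i = 𝟙 (τ i ≟ᵀ t)

  reachable-head : ∀ {k} (τ : Fin (suc k) → T) (s : T → F₂²) →
                   (∀ t → Reachable (weight (colourClass τ t)) (s t)) →
                   Reachable (suc (weight (colourClass (τ ∘ suc) (τ zero)))) (s (τ zero))
  reachable-head τ s reach with τ zero ≟ᵀ τ zero | reach (τ zero)
  ... | yes _ | r = r
  ... | no ¬r | _ = ⊥-elim (¬r refl)

  reachable-tail : ∀ {k} (τ : Fin (suc k) → T) (s : T → F₂²) x →
                   (∀ t → Reachable (weight (colourClass τ t)) (s t)) →
                   Reachable (weight (colourClass (τ ∘ suc) (τ zero))) (s (τ zero) +² x) →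
                   ∀ t → Reachable (weight (colourClass (τ ∘ suc) t)) (s t +² (𝟙 (τ zero ≟ᵀ t) ·² x))
  reachable-tail τ s x reach reach-x t with τ zero ≟ᵀ t | reach t
  ... | yes refl | _ = reach-x
  ... | no _     | r = subst (Reachable _) (sym (cong₂ _,_ (ℙP.+-identityʳ _) (ℙP.+-identityʳ _))) r

  realise-class-sums : ∀ {k} (τ : Fin k → T) (s : T → F₂²) →
    (∀ t → Reachable (weight (colourClass τ t)) (s t)) →
    ∃[ p ] ∃[ q ] (∀ i → (p i , q i) ≢ 0²) ×
      (∀ t → colourClass τ t · p ≡ proj₁ (s t)) × (∀ t → colourClass τ t · q ≡ proj₂ (s t))
  realise-class-sums {zero} τ s reach =
    (λ ()) , (λ ()) , (λ ()) ,
    (λ t → sym (cong proj₁ (proj₁ (reach t) refl))) , (λ t → sym (cong proj₂ (proj₁ (reach t) refl)))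
  realise-class-sums {suc k} τ s reach with reachable-step _ (s (τ zero)) (reachable-head τ s reach)
  ... | x@(x₁ , x₂) , x≢0 , reach-x
    with realise-class-sums (τ ∘ suc) (λ t → s t +² (𝟙 (τ zero ≟ᵀ t) ·² x)) (reachable-tail τ s x reach reach-x)
  ... | p , q , pq≢0 , sum-p , sum-q =
    x₁ ∷ᵥ p , x₂ ∷ᵥ q , (λ { zero → x≢0 ; (suc i) → pq≢0 i }) ,
    (λ t → trans (cong (𝟙 (τ zero ≟ᵀ t) ℙ.* x₁ ℙ.+_) (sum-p t)) (a+[b+a]≡b (𝟙 (τ zero ≟ᵀ t) ℙ.* x₁) _)) ,
    (λ t → trans (cong (𝟙 (τ zero ≟ᵀ t) ℙ.* x₂ ℙ.+_) (sum-q t)) (a+[b+a]≡b (𝟙 (τ zero ≟ᵀ t) ℙ.* x₂) _))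
    where
    a+[b+a]≡b : ∀ a b → a ℙ.+ (b ℙ.+ a) ≡ b
    a+[b+a]≡b 0ℙ 0ℙ = refl
    a+[b+a]≡b 0ℙ 1ℙ = refl
    a+[b+a]≡b 1ℙ 0ℙ = refl
    a+[b+a]≡b 1ℙ 1ℙ = refl

-- Coordinates are coloured by their columns (A i , B i). Then A · p is the sum of the class sums of p
-- for the colours (1 , 0) and (1 , 1), similarly for B, and these class sums are all chosen equal.
module _ {k} (A B : Fin k → Parity) where
  private
    C : F₂² → Fin k → Parity
    C = colourClass _≟²_ (λ i → A i , B i)

    A-classes : ∀ i → toℕ (A i) ≡ toℕ (C (1ℙ , 0ℙ) i) ℕ.+ toℕ (C (1ℙ , 1ℙ) i)
    A-classes i with A i | B i
    ... | 0ℙ | 0ℙ = refl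
    ... | 0ℙ | 1ℙ = refl
    ... | 1ℙ | 0ℙ = refl
    ... | 1ℙ | 1ℙ = refl

    B-classes : ∀ i → toℕ (B i) ≡ toℕ (C (0ℙ , 1ℙ) i) ℕ.+ toℕ (C (1ℙ , 1ℙ) i)
    B-classes i with A i | B i
    ... | 0ℙ | 0ℙ = refl
    ... | 0ℙ | 1ℙ = refl
    ... | 1ℙ | 0ℙ = refl
    ... | 1ℙ | 1ℙ = refl

    A+B-classes : ∀ i → toℕ (A i ℙ.+ B i) ≡ toℕ (C (1ℙ , 0ℙ) i) ℕ.+ toℕ (C (0ℙ , 1ℙ) i)
    A+B-classes i with A i | B i
    ... | 0ℙ | 0ℙ = refl
    ... | 0ℙ | 1ℙ = refl
    ... | 1ℙ | 0ℙ = refl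
    ... | 1ℙ | 1ℙ = refl

    non-unit⇒weight≢1 : ∀ {x y z : Fin k → Parity} → ¬ IsUnitVector x →
                         (∀ i → toℕ (x i) ≡ toℕ (y i) ℕ.+ toℕ (z i)) → weight y ℕ.+ weight z ≢ 1
    non-unit⇒weight≢1 {x} x≢e split w≡1 = x≢e (weight≡1⇒unit x (trans (weight-split split) w≡1))

    orthogonal : ∀ {x y z : Fin k → Parity} {s} → (∀ i → toℕ (x i) ≡ toℕ (y i) ℕ.+ toℕ (z i)) →
                 ∀ p → y · p ≡ s → z · p ≡ s → x · p ≡ 0ℙ
    orthogonal {s = s} split p y·p≡s z·p≡s = trans (·-split split p) (trans (cong₂ ℙ._+_ y·p≡s z·p≡s) (ℙP.p+p≡0ℙ s))

    target : F₂² → F₂² → F₂² → F₂²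
    target s s₀₀ (0ℙ , 0ℙ) = s₀₀
    target s s₀₀ (0ℙ , 1ℙ) = s
    target s s₀₀ (1ℙ , _)  = s

    reachable-target : ∀ {s s₀₀} →
      Reachable (weight (C (0ℙ , 0ℙ))) s₀₀ → Reachable (weight (C (1ℙ , 0ℙ))) s →
      Reachable (weight (C (0ℙ , 1ℙ))) s → Reachable (weight (C (1ℙ , 1ℙ))) s →
      ∀ t → Reachable (weight (C t)) (target s s₀₀ t)
    reachable-target r₀₀ _ _ _ (0ℙ , 0ℙ) = r₀₀
    reachable-target _ r₁₀ _ _ (1ℙ , 0ℙ) = r₁₀
    reachable-target _ _ r₀₁ _ (0ℙ , 1ℙ) = r₀₁
    reachable-target _ _ _ r₁₁ (1ℙ , 1ℙ) = r₁₁

  orthogonal-cover : ¬ IsUnitVector A → ¬ IsUnitVector B → ¬ IsUnitVector (λ i → A i ℙ.+ B i) →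
    ∃[ p ] ∃[ q ] (∀ i → (p i , q i) ≢ 0²) × (A · p ≡ 0ℙ × B · p ≡ 0ℙ) × (A · q ≡ 0ℙ × B · q ≡ 0ℙ)
  orthogonal-cover A≢e B≢e A+B≢e
    with common-target (weight (C (1ℙ , 0ℙ))) (weight (C (0ℙ , 1ℙ))) (weight (C (1ℙ , 1ℙ)))
           (non-unit⇒weight≢1 A≢e A-classes) (non-unit⇒weight≢1 B≢e B-classes)
           (non-unit⇒weight≢1 A+B≢e A+B-classes)
       | reachable-some (weight (C (0ℙ , 0ℙ)))
  ... | s , r₁₀ , r₀₁ , r₁₁ | s₀₀ , r₀₀
    with realise-class-sums _≟²_ (λ i → A i , B i) (target s s₀₀) (reachable-target r₀₀ r₁₀ r₀₁ r₁₁)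
  ... | p , q , pq≢0 , sum-p , sum-q =
    p , q , pq≢0 ,
    (orthogonal A-classes p (sum-p (1ℙ , 0ℙ)) (sum-p (1ℙ , 1ℙ)) , orthogonal B-classes p (sum-p (0ℙ , 1ℙ)) (sum-p (1ℙ , 1ℙ))) ,
    (orthogonal A-classes q (sum-q (1ℙ , 0ℙ)) (sum-q (1ℙ , 1ℙ)) , orthogonal B-classes q (sum-q (0ℙ , 1ℙ)) (sum-q (1ℙ , 1ℙ)))

-- Integer relations among vectors of a rational plane

-- Defs.toℚ without its graph parameters.
fromℤ : ℤ → ℚ
fromℤ i = i ℚ./ 1

private
  toℚᵘ-fromℤ : ∀ i → ℚ.toℚᵘ (fromℤ i) ℚᵘ.≃ mkℚᵘ i 0
  toℚᵘ-fromℤ i = ℚP.toℚᵘ-fromℚᵘ (mkℚᵘ i 0)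

fromℤ-injective : ∀ {i j} → fromℤ i ≡ fromℤ j → i ≡ j
fromℤ-injective {i} {j} eq with ℚP.fromℚᵘ-injective {mkℚᵘ i 0} {mkℚᵘ j 0} eq
... | *≡* i*1≡j*1 = trans (sym (ℤP.*-identityʳ i)) (trans i*1≡j*1 (ℤP.*-identityʳ j))

fromℤ-+ : ∀ i j → fromℤ (i ℤ.+ j) ≡ fromℤ i ℚ.+ fromℤ j
fromℤ-+ i j = ℚP.toℚᵘ-injective (begin
  ℚ.toℚᵘ (fromℤ (i ℤ.+ j))                ≈⟨ toℚᵘ-fromℤ (i ℤ.+ j) ⟩
  mkℚᵘ (i ℤ.+ j) 0                        ≈⟨ *≡* (solve 2 (λ i j → (i :+ j) :* con (+ 1) :=
                                                                  (i :* con (+ 1) :+ j :* con (+ 1)) :* con (+ 1))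
                                                       refl i j) ⟩
  mkℚᵘ i 0 ℚᵘ.+ mkℚᵘ j 0                  ≈⟨ ℚᵘP.+-cong (toℚᵘ-fromℤ i) (toℚᵘ-fromℤ j) ⟨
  ℚ.toℚᵘ (fromℤ i) ℚᵘ.+ ℚ.toℚᵘ (fromℤ j)  ≈⟨ ℚP.toℚᵘ-homo-+ (fromℤ i) (fromℤ j) ⟨
  ℚ.toℚᵘ (fromℤ i ℚ.+ fromℤ j)            ∎)
  where open ℚᵘP.≃-Reasoning
        open ℤ-Solver

fromℤ-* : ∀ i j → fromℤ (i ℤ.* j) ≡ fromℤ i ℚ.* fromℤ j
fromℤ-* i j = ℚP.toℚᵘ-injective (begin
  ℚ.toℚᵘ (fromℤ (i ℤ.* j))                ≈⟨ toℚᵘ-fromℤ (i ℤ.* j) ⟩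
  mkℚᵘ (i ℤ.* j) 0                        ≈⟨ ℚᵘP.*-cong (toℚᵘ-fromℤ i) (toℚᵘ-fromℤ j) ⟨
  ℚ.toℚᵘ (fromℤ i) ℚᵘ.* ℚ.toℚᵘ (fromℤ j)  ≈⟨ ℚP.toℚᵘ-homo-* (fromℤ i) (fromℤ j) ⟨
  ℚ.toℚᵘ (fromℤ i ℚ.* fromℤ j)            ∎)
  where open ℚᵘP.≃-Reasoning

fromℤ-↥ : ∀ c → fromℤ (↥ c) ≡ c ℚ.* fromℤ (↧ c)
fromℤ-↥ c@(mkℚ n d _) = ℚP.toℚᵘ-injective (begin
  ℚ.toℚᵘ (fromℤ n)                        ≈⟨ toℚᵘ-fromℤ n ⟩
  mkℚᵘ n 0                                ≈⟨ *≡* (solve 2 (λ n d → n :* (d :* con (+ 1)) := (n :* d) :* con (+ 1)) refl n (+ suc d)) ⟩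
  mkℚᵘ n d ℚᵘ.* mkℚᵘ (+ suc d) 0          ≈⟨ ℚᵘP.*-congˡ {mkℚᵘ n d} (toℚᵘ-fromℤ (+ suc d)) ⟨
  ℚ.toℚᵘ c ℚᵘ.* ℚ.toℚᵘ (fromℤ (↧ c))      ≈⟨ ℚP.toℚᵘ-homo-* c (fromℤ (↧ c)) ⟨
  ℚ.toℚᵘ (c ℚ.* fromℤ (↧ c))              ∎)
  where open ℚᵘP.≃-Reasoning
        open ℤ-Solver

fromℤ-↥* : ∀ c k → fromℤ (↥ c ℤ.* k) ≡ c ℚ.* fromℤ (↧ c ℤ.* k)
fromℤ-↥* c k = begin
  fromℤ (↥ c ℤ.* k)                  ≡⟨ fromℤ-* (↥ c) k ⟩
  fromℤ (↥ c) ℚ.* fromℤ k            ≡⟨ cong (ℚ._* fromℤ k) (fromℤ-↥ c) ⟩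
  c ℚ.* fromℤ (↧ c) ℚ.* fromℤ k      ≡⟨ ℚP.*-assoc c (fromℤ (↧ c)) (fromℤ k) ⟩
  c ℚ.* (fromℤ (↧ c) ℚ.* fromℤ k)    ≡⟨ cong (c ℚ.*_) (fromℤ-* (↧ c) k) ⟨
  c ℚ.* fromℤ (↧ c ℤ.* k)            ∎
  where open ≡-Reasoning

fromℤ-linear₃ : ∀ a b c x y z → fromℤ (a ℤ.* x ℤ.+ b ℤ.* y ℤ.+ c ℤ.* z) ≡
                fromℤ a ℚ.* fromℤ x ℚ.+ fromℤ b ℚ.* fromℤ y ℚ.+ fromℤ c ℚ.* fromℤ z
fromℤ-linear₃ a b c x y z = begin
  fromℤ (a ℤ.* x ℤ.+ b ℤ.* y ℤ.+ c ℤ.* z)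
    ≡⟨ fromℤ-+ (a ℤ.* x ℤ.+ b ℤ.* y) (c ℤ.* z) ⟩
  fromℤ (a ℤ.* x ℤ.+ b ℤ.* y) ℚ.+ fromℤ (c ℤ.* z)
    ≡⟨ cong₂ ℚ._+_ (fromℤ-+ (a ℤ.* x) (b ℤ.* y)) (fromℤ-* c z) ⟩
  fromℤ (a ℤ.* x) ℚ.+ fromℤ (b ℤ.* y) ℚ.+ fromℤ c ℚ.* fromℤ z
    ≡⟨ cong₂ (λ s t → s ℚ.+ t ℚ.+ fromℤ c ℚ.* fromℤ z) (fromℤ-* a x) (fromℤ-* b y) ⟩
  fromℤ a ℚ.* fromℤ x ℚ.+ fromℤ b ℚ.* fromℤ y ℚ.+ fromℤ c ℚ.* fromℤ z ∎
  where open ≡-Reasoning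

plane-dependent : ∀ (a₁ b₁ a₂ b₂ a₃ b₃ : ℚ) → ∃[ c₁ ] ∃[ c₂ ] ∃[ c₃ ] ¬ (c₁ ≡ 0ℚ × c₂ ≡ 0ℚ × c₃ ≡ 0ℚ) ×
  (c₁ ℚ.* a₁ ℚ.+ c₂ ℚ.* a₂ ℚ.+ c₃ ℚ.* a₃ ≡ 0ℚ) × (c₁ ℚ.* b₁ ℚ.+ c₂ ℚ.* b₂ ℚ.+ c₃ ℚ.* b₃ ≡ 0ℚ)
plane-dependent a₁ b₁ a₂ b₂ a₃ b₃ with (minor₁ ℚP.≟ 0ℚ) ×-dec (minor₂ ℚP.≟ 0ℚ) ×-dec (minor₃ ℚP.≟ 0ℚ)
  where
  minor₁ = a₂ ℚ.* b₃ ℚ.- a₃ ℚ.* b₂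
  minor₂ = a₃ ℚ.* b₁ ℚ.- a₁ ℚ.* b₃
  minor₃ = a₁ ℚ.* b₂ ℚ.- a₂ ℚ.* b₁
... | no minors≢0 = _ , _ , _ , minors≢0 ,
  solve 6 (λ a₁ b₁ a₂ b₂ a₃ b₃ →
    (a₂ :* b₃ :- a₃ :* b₂) :* a₁ :+ (a₃ :* b₁ :- a₁ :* b₃) :* a₂ :+ (a₁ :* b₂ :- a₂ :* b₁) :* a₃ := con 0ℚ)
    refl a₁ b₁ a₂ b₂ a₃ b₃ ,
  solve 6 (λ a₁ b₁ a₂ b₂ a₃ b₃ →
    (a₂ :* b₃ :- a₃ :* b₂) :* b₁ :+ (a₃ :* b₁ :- a₁ :* b₃) :* b₂ :+ (a₁ :* b₂ :- a₂ :* b₁) :* b₃ := con 0ℚ)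
    refl a₁ b₁ a₂ b₂ a₃ b₃
  where open ℚ-Solver
... | yes (_ , _ , minor₃≡0) with a₁ ℚP.≟ 0ℚ | b₁ ℚP.≟ 0ℚ
...   | no a₁≢0 | _ = ℚ.- a₂ , a₁ , 0ℚ , (λ (_ , a₁≡0 , _) → a₁≢0 a₁≡0) ,
  solve 3 (λ a₁ a₂ a₃ → (:- a₂) :* a₁ :+ a₁ :* a₂ :+ con 0ℚ :* a₃ := con 0ℚ) refl a₁ a₂ a₃ ,
  trans (solve 5 (λ a₁ b₁ a₂ b₂ b₃ → (:- a₂) :* b₁ :+ a₁ :* b₂ :+ con 0ℚ :* b₃ := a₁ :* b₂ :- a₂ :* b₁)
                 refl a₁ b₁ a₂ b₂ b₃)
        minor₃≡0
  where open ℚ-Solver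
...   | yes _ | no b₁≢0 = ℚ.- b₂ , b₁ , 0ℚ , (λ (_ , b₁≡0 , _) → b₁≢0 b₁≡0) ,
  trans (solve 5 (λ a₁ b₁ a₂ b₂ a₃ → (:- b₂) :* a₁ :+ b₁ :* a₂ :+ con 0ℚ :* a₃ := :- (a₁ :* b₂ :- a₂ :* b₁))
                 refl a₁ b₁ a₂ b₂ a₃)
        (cong ℚ.-_ minor₃≡0) ,
  solve 3 (λ b₁ b₂ b₃ → (:- b₂) :* b₁ :+ b₁ :* b₂ :+ con 0ℚ :* b₃ := con 0ℚ) refl b₁ b₂ b₃
  where open ℚ-Solver
...   | yes a₁≡0 | yes b₁≡0 = 1ℚ , 0ℚ , 0ℚ , (λ ()) ,
  trans (solve 3 (λ a₁ a₂ a₃ → con 1ℚ :* a₁ :+ con 0ℚ :* a₂ :+ con 0ℚ :* a₃ := a₁) refl a₁ a₂ a₃) a₁≡0 ,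
  trans (solve 3 (λ b₁ b₂ b₃ → con 1ℚ :* b₁ :+ con 0ℚ :* b₂ :+ con 0ℚ :* b₃ := b₁) refl b₁ b₂ b₃) b₁≡0
  where open ℚ-Solver

scaled-relation : ∀ {c₁ c₂ c₃ C₁ C₂ C₃} D →
  fromℤ C₁ ≡ c₁ ℚ.* fromℤ D → fromℤ C₂ ≡ c₂ ℚ.* fromℤ D → fromℤ C₃ ≡ c₃ ℚ.* fromℤ D →
  ∀ x y z → c₁ ℚ.* fromℤ x ℚ.+ c₂ ℚ.* fromℤ y ℚ.+ c₃ ℚ.* fromℤ z ≡ 0ℚ →
  C₁ ℤ.* x ℤ.+ C₂ ℤ.* y ℤ.+ C₃ ℤ.* z ≡ 0ℤ
scaled-relation {c₁} {c₂} {c₃} {C₁} {C₂} {C₃} D C₁≡ C₂≡ C₃≡ x y z rel = fromℤ-injective (begin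
  fromℤ (C₁ ℤ.* x ℤ.+ C₂ ℤ.* y ℤ.+ C₃ ℤ.* z)
    ≡⟨ fromℤ-linear₃ C₁ C₂ C₃ x y z ⟩
  fromℤ C₁ ℚ.* X ℚ.+ fromℤ C₂ ℚ.* Y ℚ.+ fromℤ C₃ ℚ.* Z
    ≡⟨ cong₂ ℚ._+_ (cong₂ ℚ._+_ (cong (ℚ._* X) C₁≡) (cong (ℚ._* Y) C₂≡)) (cong (ℚ._* Z) C₃≡) ⟩
  c₁ ℚ.* d ℚ.* X ℚ.+ c₂ ℚ.* d ℚ.* Y ℚ.+ c₃ ℚ.* d ℚ.* Z
    ≡⟨ solve 7 (λ c₁ c₂ c₃ d X Y Z → c₁ :* d :* X :+ c₂ :* d :* Y :+ c₃ :* d :* Z := d :* (c₁ :* X :+ c₂ :* Y :+ c₃ :* Z))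
         refl c₁ c₂ c₃ d X Y Z ⟩
  d ℚ.* (c₁ ℚ.* X ℚ.+ c₂ ℚ.* Y ℚ.+ c₃ ℚ.* Z)
    ≡⟨ cong (d ℚ.*_) rel ⟩
  d ℚ.* 0ℚ
    ≡⟨ ℚP.*-zeroʳ d ⟩
  0ℚ ∎)
  where
  open ≡-Reasoning
  open ℚ-Solver
  d = fromℤ D
  X = fromℤ x
  Y = fromℤ y
  Z = fromℤ z

↥*↧*↧≡0⇒≡0 : ∀ c d e → ↥ c ℤ.* (↧ d ℤ.* ↧ e) ≡ 0ℤ → c ≡ 0ℚ
↥*↧*↧≡0⇒≡0 c d e product≡0 with ℤP.i*j≡0⇒i≡0∨j≡0 (↥ c) product≡0
... | inj₁ ↥c≡0 = ℚP.↥p≡0⇒p≡0 c ↥c≡0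
... | inj₂ ↧↧≡0 = ⊥-elim ([ ↧≢0 d , ↧≢0 e ]′ (ℤP.i*j≡0⇒i≡0∨j≡0 (↧ d) ↧↧≡0))
  where ↧≢0 : ∀ c → ↧ c ≢ 0ℤ
        ↧≢0 (mkℚ _ _ _) ()

clear-denominators : ∀ c₁ c₂ c₃ → ¬ (c₁ ≡ 0ℚ × c₂ ≡ 0ℚ × c₃ ≡ 0ℚ) →
  ∃[ C₁ ] ∃[ C₂ ] ∃[ C₃ ] ¬ (C₁ ≡ 0ℤ × C₂ ≡ 0ℤ × C₃ ≡ 0ℤ) ×
    (∀ x y z → c₁ ℚ.* fromℤ x ℚ.+ c₂ ℚ.* fromℤ y ℚ.+ c₃ ℚ.* fromℤ z ≡ 0ℚ →
               C₁ ℤ.* x ℤ.+ C₂ ℤ.* y ℤ.+ C₃ ℤ.* z ≡ 0ℤ)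
clear-denominators c₁ c₂ c₃ c≢0 =
  C₁ , C₂ , C₃ ,
  (λ (C₁≡0 , C₂≡0 , C₃≡0) →
     c≢0 (↥*↧*↧≡0⇒≡0 c₁ c₂ c₃ C₁≡0 , ↥*↧*↧≡0⇒≡0 c₂ c₁ c₃ C₂≡0 , ↥*↧*↧≡0⇒≡0 c₃ c₁ c₂ C₃≡0)) ,
  scaled-relation {c₁} {c₂} {c₃} {C₁} {C₂} {C₃} D
    (fromℤ-↥* c₁ (↧ c₂ ℤ.* ↧ c₃))
    (trans (fromℤ-↥* c₂ (↧ c₁ ℤ.* ↧ c₃))
           (cong (λ t → c₂ ℚ.* fromℤ t) (solve 3 (λ a b c → b :* (a :* c) := a :* (b :* c)) refl (↧ c₁) (↧ c₂) (↧ c₃))))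
    (trans (fromℤ-↥* c₃ (↧ c₁ ℤ.* ↧ c₂))
           (cong (λ t → c₃ ℚ.* fromℤ t) (solve 3 (λ a b c → c :* (a :* b) := a :* (b :* c)) refl (↧ c₁) (↧ c₂) (↧ c₃))))
  where
  open ℤ-Solver
  C₁ = ↥ c₁ ℤ.* (↧ c₂ ℤ.* ↧ c₃)
  C₂ = ↥ c₂ ℤ.* (↧ c₁ ℤ.* ↧ c₃)
  C₃ = ↥ c₃ ℤ.* (↧ c₁ ℤ.* ↧ c₂)
  D  = ↧ c₁ ℤ.* (↧ c₂ ℤ.* ↧ c₃)

size : ℤ → ℤ → ℤ → ℕ
size a b c = ℤ.∣ a ∣ ℕ.+ ℤ.∣ b ∣ ℕ.+ ℤ.∣ c ∣

size-*2 : ∀ a b c → ¬ (a ≡ 0ℤ × b ≡ 0ℤ × c ≡ 0ℤ) → size a b c < size (a ℤ.* + 2) (b ℤ.* + 2) (c ℤ.* + 2)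
size-*2 a b c abc≢0 = begin-strict
  size a b c                                        <⟨ ℕP.m<m*n (size a b c) 2 ℕP.≤-refl ⟩
  size a b c ℕ.* 2                                  ≡⟨ solve 3 (λ x y z → (x :+ y :+ z) :* con 2 := x :* con 2 :+ y :* con 2 :+ z :* con 2)
                                                             refl ℤ.∣ a ∣ ℤ.∣ b ∣ ℤ.∣ c ∣ ⟩
  ℤ.∣ a ∣ ℕ.* 2 ℕ.+ ℤ.∣ b ∣ ℕ.* 2 ℕ.+ ℤ.∣ c ∣ ℕ.* 2  ≡⟨ cong₂ ℕ._+_ (cong₂ ℕ._+_ (ℤP.abs-* a (+ 2)) (ℤP.abs-* b (+ 2)))
                                                                 (ℤP.abs-* c (+ 2)) ⟨
  size (a ℤ.* + 2) (b ℤ.* + 2) (c ℤ.* + 2)          ∎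
  where
  open ℕP.≤-Reasoning
  open ℕ-Solver
  instance
    size≢0 : ℕ.NonZero (size a b c)
    size≢0 = ℕ.≢-nonZero λ size≡0 → abc≢0
      ( ℤP.∣i∣≡0⇒i≡0 (ℕP.m+n≡0⇒m≡0 _ (ℕP.m+n≡0⇒m≡0 _ size≡0))
      , ℤP.∣i∣≡0⇒i≡0 (ℕP.m+n≡0⇒n≡0 ℤ.∣ a ∣ (ℕP.m+n≡0⇒m≡0 _ size≡0))
      , ℤP.∣i∣≡0⇒i≡0 (ℕP.m+n≡0⇒n≡0 (ℤ.∣ a ∣ ℕ.+ ℤ.∣ b ∣) size≡0))

module _ (P : ℤ → ℤ → ℤ → Set) (halve : ∀ {a b c} → P (a ℤ.* + 2) (b ℤ.* + 2) (c ℤ.* + 2) → P a b c) where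

  odd-solution : ∀ {a b c} → ¬ (a ≡ 0ℤ × b ≡ 0ℤ × c ≡ 0ℤ) → P a b c →
    ∃[ a ] ∃[ b ] ∃[ c ] ¬ (parityℤ a ≡ 0ℙ × parityℤ b ≡ 0ℙ × parityℤ c ≡ 0ℙ) × P a b c
  odd-solution = descend (<-wellFounded _)
    where
    descend : ∀ {a b c} → Acc _<_ (size a b c) → ¬ (a ≡ 0ℤ × b ≡ 0ℤ × c ≡ 0ℤ) → P a b c →
      ∃[ a ] ∃[ b ] ∃[ c ] ¬ (parityℤ a ≡ 0ℙ × parityℤ b ≡ 0ℙ × parityℤ c ≡ 0ℙ) × P a b c
    descend {a} {b} {c} (acc smaller) abc≢0 Pabc
      with (parityℤ a ℙP.≟ 0ℙ) ×-dec (parityℤ b ℙP.≟ 0ℙ) ×-dec (parityℤ c ℙP.≟ 0ℙ)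
    ... | no some-odd = a , b , c , some-odd , Pabc
    ... | yes (a-even , b-even , c-even)
      with parityℤ≡0ℙ⇒double a a-even | parityℤ≡0ℙ⇒double b b-even | parityℤ≡0ℙ⇒double c c-even
    ... | a′ , refl | b′ , refl | c′ , refl = descend (smaller (size-*2 a′ b′ c′ abc′≢0)) abc′≢0 (halve Pabc)
      where abc′≢0 : ¬ (a′ ≡ 0ℤ × b′ ≡ 0ℤ × c′ ≡ 0ℤ)
            abc′≢0 (a′≡0 , b′≡0 , c′≡0) =
              abc≢0 (cong (ℤ._* + 2) a′≡0 , cong (ℤ._* + 2) b′≡0 , cong (ℤ._* + 2) c′≡0)

InPlane : ∀ {k} (u w x : Fin k → ℚ) → Set
InPlane u w x = ∃[ α ] ∃[ β ] ∀ i → x i ≡ (α ℚ.* u i) ℚ.+ (β ℚ.* w i)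

module _ {k} (y₁ y₂ y₃ : Fin k → ℤ) where

  IntegerRelation : ℤ → ℤ → ℤ → Set
  IntegerRelation a b c = ∀ i → a ℤ.* y₁ i ℤ.+ b ℤ.* y₂ i ℤ.+ c ℤ.* y₃ i ≡ 0ℤ

  integer-relation-halve : ∀ {a b c} → IntegerRelation (a ℤ.* + 2) (b ℤ.* + 2) (c ℤ.* + 2) → IntegerRelation a b c
  integer-relation-halve {a} {b} {c} rel i = ℤP.*-cancelʳ-≡ (a ℤ.* y₁ i ℤ.+ b ℤ.* y₂ i ℤ.+ c ℤ.* y₃ i) 0ℤ (+ 2) (trans
    (solve 6 (λ a b c x y z → (a :* x :+ b :* y :+ c :* z) :* con (+ 2) :=
                              (a :* con (+ 2)) :* x :+ (b :* con (+ 2)) :* y :+ (c :* con (+ 2)) :* z)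
       refl a b c (y₁ i) (y₂ i) (y₃ i))
    (rel i))
    where open ℤ-Solver

  integer-relation-parity : ∀ {a b c} → IntegerRelation a b c → ∀ i →
    (parityℤ a ℙ.* parityℤ (y₁ i)) ℙ.+ (parityℤ b ℙ.* parityℤ (y₂ i)) ℙ.+ (parityℤ c ℙ.* parityℤ (y₃ i)) ≡ 0ℙ
  integer-relation-parity {a} {b} {c} rel i = begin
    (parityℤ a ℙ.* parityℤ (y₁ i)) ℙ.+ (parityℤ b ℙ.* parityℤ (y₂ i)) ℙ.+ (parityℤ c ℙ.* parityℤ (y₃ i))
      ≡⟨ cong₂ ℙ._+_ (cong₂ ℙ._+_ (parityℤ-* a (y₁ i)) (parityℤ-* b (y₂ i))) (parityℤ-* c (y₃ i)) ⟨
    parityℤ (a ℤ.* y₁ i) ℙ.+ parityℤ (b ℤ.* y₂ i) ℙ.+ parityℤ (c ℤ.* y₃ i)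
      ≡⟨ cong (ℙ._+ parityℤ (c ℤ.* y₃ i)) (parityℤ-+ (a ℤ.* y₁ i) (b ℤ.* y₂ i)) ⟨
    parityℤ (a ℤ.* y₁ i ℤ.+ b ℤ.* y₂ i) ℙ.+ parityℤ (c ℤ.* y₃ i)
      ≡⟨ parityℤ-+ (a ℤ.* y₁ i ℤ.+ b ℤ.* y₂ i) (c ℤ.* y₃ i) ⟨
    parityℤ (a ℤ.* y₁ i ℤ.+ b ℤ.* y₂ i ℤ.+ c ℤ.* y₃ i)
      ≡⟨ cong parityℤ (rel i) ⟩
    0ℙ ∎
    where open ≡-Reasoning

  in-plane⇒integer-relation : ∀ {u w} →
    InPlane u w (fromℤ ∘ y₁) → InPlane u w (fromℤ ∘ y₂) → InPlane u w (fromℤ ∘ y₃) →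
    ∃[ a ] ∃[ b ] ∃[ c ] ¬ (a ≡ 0ℤ × b ≡ 0ℤ × c ≡ 0ℤ) × IntegerRelation a b c
  in-plane⇒integer-relation {u} {w} (a₁ , b₁ , y₁≡) (a₂ , b₂ , y₂≡) (a₃ , b₃ , y₃≡) =
    let c₁ , c₂ , c₃ , c≢0 , ∑ca≡0 , ∑cb≡0 = plane-dependent a₁ b₁ a₂ b₂ a₃ b₃
        C₁ , C₂ , C₃ , C≢0 , integral = clear-denominators c₁ c₂ c₃ c≢0
    in C₁ , C₂ , C₃ , C≢0 , λ i → integral (y₁ i) (y₂ i) (y₃ i) (begin
      c₁ ℚ.* fromℤ (y₁ i) ℚ.+ c₂ ℚ.* fromℤ (y₂ i) ℚ.+ c₃ ℚ.* fromℤ (y₃ i)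
        ≡⟨ cong₂ ℚ._+_ (cong₂ ℚ._+_ (cong (c₁ ℚ.*_) (y₁≡ i)) (cong (c₂ ℚ.*_) (y₂≡ i))) (cong (c₃ ℚ.*_) (y₃≡ i)) ⟩
      c₁ ℚ.* (a₁ ℚ.* u i ℚ.+ b₁ ℚ.* w i) ℚ.+ c₂ ℚ.* (a₂ ℚ.* u i ℚ.+ b₂ ℚ.* w i) ℚ.+ c₃ ℚ.* (a₃ ℚ.* u i ℚ.+ b₃ ℚ.* w i)
        ≡⟨ solve 11 (λ c₁ c₂ c₃ a₁ a₂ a₃ b₁ b₂ b₃ u w →
             c₁ :* (a₁ :* u :+ b₁ :* w) :+ c₂ :* (a₂ :* u :+ b₂ :* w) :+ c₃ :* (a₃ :* u :+ b₃ :* w) :=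
             (c₁ :* a₁ :+ c₂ :* a₂ :+ c₃ :* a₃) :* u :+ (c₁ :* b₁ :+ c₂ :* b₂ :+ c₃ :* b₃) :* w)
             refl c₁ c₂ c₃ a₁ a₂ a₃ b₁ b₂ b₃ (u i) (w i) ⟩
      (c₁ ℚ.* a₁ ℚ.+ c₂ ℚ.* a₂ ℚ.+ c₃ ℚ.* a₃) ℚ.* u i ℚ.+ (c₁ ℚ.* b₁ ℚ.+ c₂ ℚ.* b₂ ℚ.+ c₃ ℚ.* b₃) ℚ.* w i
        ≡⟨ cong₂ (λ s t → s ℚ.* u i ℚ.+ t ℚ.* w i) ∑ca≡0 ∑cb≡0 ⟩
      0ℚ ℚ.* u i ℚ.+ 0ℚ ℚ.* w i
        ≡⟨ cong₂ ℚ._+_ (ℚP.*-zeroˡ (u i)) (ℚP.*-zeroˡ (w i)) ⟩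
      0ℚ ∎)
    where open ≡-Reasoning
          open ℚ-Solver

  parities-dependent : ∀ {u w} → InPlane u w (fromℤ ∘ y₁) → InPlane u w (fromℤ ∘ y₂) → InPlane u w (fromℤ ∘ y₃) →
    Dependent (parityℤ ∘ y₁) (parityℤ ∘ y₂) (parityℤ ∘ y₃)
  parities-dependent y₁∈ y₂∈ y₃∈ =
    let _ , _ , _ , C≢0 , C-relation = in-plane⇒integer-relation y₁∈ y₂∈ y₃∈
        a , b , c , odd , relation =
          odd-solution IntegerRelation (λ {a} {b} {c} → integer-relation-halve {a} {b} {c}) C≢0 C-relation
    in parityℤ a , parityℤ b , parityℤ c , odd , integer-relation-parity {a} {b} {c} relation

-- Balanced reorientations of even multigraphs

data Reorientation {V : Set} : V × V → V × V → Set where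
  keep : ∀ {e} → Reorientation e e
  flip : ∀ {e} → Reorientation e (swap e)

sign : ∀ {V} {e e′ : V × V} → Reorientation e e′ → Sign
sign keep = Sign.+
sign flip = Sign.-

reorientation-sym : ∀ {V} {e e′ : V × V} → Reorientation e e′ → Reorientation e′ e
reorientation-sym keep = keep
reorientation-sym flip = flip

reorientation-trans : ∀ {V} {e e′ e″ : V × V} → Reorientation e e′ → Reorientation e′ e″ → Reorientation e e″
reorientation-trans keep r    = r
reorientation-trans flip keep = flip
reorientation-trans flip flip = keep

Pointwise-++⁻ : ∀ {A B : Set} {R : A → B → Set} xs {ys zs} → Pointwise R (xs ++ ys) zs →
                ∃[ zs₁ ] ∃[ zs₂ ] zs ≡ zs₁ ++ zs₂ × Pointwise R xs zs₁ × Pointwise R ys zs₂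
Pointwise-++⁻ []       rs       = [] , _ , refl , [] , rs
Pointwise-++⁻ (x ∷ xs) (r ∷ rs) with Pointwise-++⁻ xs rs
... | zs₁ , zs₂ , refl , rs₁ , rs₂ = _ ∷ zs₁ , zs₂ , refl , r ∷ rs₁ , rs₂

module _ {V : Set} (_≟ᵛ_ : DecidableEquality V) where

  ι : ∀ {P : Set} → Dec P → ℤ
  ι (yes _) = + 1
  ι (no _)  = + 0

  outflow : V → V × V → ℤ
  outflow v (a , b) = ι (a ≟ᵛ v) ℤ.- ι (b ≟ᵛ v)

  net : V → List (V × V) → ℤ
  net v []       = 0ℤ
  net v (e ∷ es) = outflow v e ℤ.+ net v es

  net-++ : ∀ v xs ys → net v (xs ++ ys) ≡ net v xs ℤ.+ net v ys
  net-++ v []       ys = sym (ℤP.+-identityˡ (net v ys))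
  net-++ v (x ∷ xs) ys = trans (cong (ℤ._+_ (outflow v x)) (net-++ v xs ys)) (sym (ℤP.+-assoc (outflow v x) _ _))

  outflow-loop : ∀ v a → outflow v (a , a) ≡ 0ℤ
  outflow-loop v a = ℤP.+-inverseʳ (ι (a ≟ᵛ v))

  net-loop : ∀ v a R → net v ((a , a) ∷ R) ≡ net v R
  net-loop v a R = trans (cong (ℤ._+ net v R) (outflow-loop v a)) (ℤP.+-identityˡ (net v R))

  outflow-path : ∀ v a b c → outflow v (a , b) ℤ.+ outflow v (b , c) ≡ outflow v (a , c)
  outflow-path v a b c = solve 3 (λ x y z → (x :- y) :+ (y :- z) := x :- z) refl (ι (a ≟ᵛ v)) (ι (b ≟ᵛ v)) (ι (c ≟ᵛ v))
    where open ℤ-Solver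

  outflow-reorient : ∀ v {e e′} (r : Reorientation e e′) → outflow v e′ ≡ (sign r ℤ.◃ 1) ℤ.* outflow v e
  outflow-reorient v keep = sym (ℤP.*-identityˡ (outflow v _))
  outflow-reorient v (flip {a , b}) =
    trans (solve 2 (λ x y → y :- x := :- (x :- y)) refl (ι (a ≟ᵛ v)) (ι (b ≟ᵛ v))) (sym (ℤP.-1*i≡-i (outflow v (a , b))))
    where open ℤ-Solver

  reorientation-subdivide : ∀ {a z y} b → Reorientation (a , z) y →
    ∃[ y₁ ] ∃[ y₂ ] Reorientation (a , b) y₁ × Reorientation (b , z) y₂ ×
                    (∀ v → outflow v y₁ ℤ.+ outflow v y₂ ≡ outflow v y)
  reorientation-subdivide {a} {z} b keep = (a , b) , (b , z) , keep , keep , λ v → outflow-path v a b z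
  reorientation-subdivide {a} {z} b flip = (b , a) , (z , b) , flip , flip , λ v →
    trans (ℤP.+-comm (outflow v (b , a)) (outflow v (z , b))) (outflow-path v z b a)

  net-splice : ∀ v {e₁ e₂ e} xs ys → outflow v e₁ ℤ.+ outflow v e₂ ≡ outflow v e →
               net v (e₁ ∷ xs ++ e₂ ∷ ys) ≡ net v (e ∷ xs ++ ys)
  net-splice v {e₁} {e₂} {e} xs ys path = begin
    outflow v e₁ ℤ.+ net v (xs ++ e₂ ∷ ys)
      ≡⟨ cong (ℤ._+_ (outflow v e₁)) (net-++ v xs (e₂ ∷ ys)) ⟩
    outflow v e₁ ℤ.+ (net v xs ℤ.+ (outflow v e₂ ℤ.+ net v ys))
      ≡⟨ solve 4 (λ a b c d → a :+ (c :+ (b :+ d)) := (a :+ b) :+ (c :+ d)) refl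
           (outflow v e₁) (outflow v e₂) (net v xs) (net v ys) ⟩
    (outflow v e₁ ℤ.+ outflow v e₂) ℤ.+ (net v xs ℤ.+ net v ys)
      ≡⟨ cong₂ ℤ._+_ path (sym (net-++ v xs ys)) ⟩
    outflow v e ℤ.+ net v (xs ++ ys) ∎
    where open ≡-Reasoning
          open ℤ-Solver

  reorientation-parity : ∀ v {L M} → Pointwise Reorientation L M → parityℤ (net v L) ≡ parityℤ (net v M)
  reorientation-parity v []                           = refl
  reorientation-parity v (_∷_ {x} {y} {xs} {ys} r rs) = begin
    parityℤ (outflow v x ℤ.+ net v xs)            ≡⟨ parityℤ-+ (outflow v x) (net v xs) ⟩
    parityℤ (outflow v x) ℙ.+ parityℤ (net v xs)  ≡⟨ cong₂ ℙ._+_ (same-parity r) (reorientation-parity v rs) ⟩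
    parityℤ (outflow v y) ℙ.+ parityℤ (net v ys)  ≡⟨ parityℤ-+ (outflow v y) (net v ys) ⟨
    parityℤ (outflow v y ℤ.+ net v ys)            ∎
    where
    open ≡-Reasoning
    same-parity : ∀ {e e′} → Reorientation e e′ → parityℤ (outflow v e) ≡ parityℤ (outflow v e′)
    same-parity keep       = refl
    same-parity (flip {e}) = trans (sym (parityℤ-neg (outflow v e)))
      (cong parityℤ (trans (sym (ℤP.-1*i≡-i (outflow v e))) (sym (outflow-reorient v (flip {e = e})))))

  odd-net⇒odd-edge : ∀ v R → parityℤ (net v R) ≡ 1ℙ →
                     ∃[ R₁ ] ∃[ x ] ∃[ R₂ ] R ≡ R₁ ++ x ∷ R₂ × parityℤ (outflow v x) ≡ 1ℙ
  odd-net⇒odd-edge v (x ∷ R) odd with parityℤ (outflow v x) in x-parity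
  ... | 1ℙ = [] , x , R , refl , x-parity
  ... | 0ℙ =
    let R₁ , y , R₂ , R≡ , y-odd = odd-net⇒odd-edge v R
          (trans (cong (ℙ._+ parityℤ (net v R)) (sym x-parity)) (trans (sym (parityℤ-+ (outflow v x) (net v R))) odd))
    in x ∷ R₁ , y , R₂ , cong (x ∷_) R≡ , y-odd

  odd-outflow⇒incident : ∀ b x → parityℤ (outflow b x) ≡ 1ℙ → ∃[ z ] Reorientation (b , z) x
  odd-outflow⇒incident b (c , d) odd with c ≟ᵛ b | d ≟ᵛ b
  odd-outflow⇒incident b (c  , d)  () | yes _    | yes _
  odd-outflow⇒incident b (.b , d)  _  | yes refl | no _     = d , keep
  odd-outflow⇒incident b (c  , .b) _  | no _     | yes refl = c , flip
  odd-outflow⇒incident b (c  , d)  () | no _     | no _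

  odd-net-after-edge : ∀ {a b R} → a ≢ b → parityℤ (net b ((a , b) ∷ R)) ≡ 0ℙ → parityℤ (net b R) ≡ 1ℙ
  odd-net-after-edge {a} {b} {R} a≢b even with a ≟ᵛ b | b ≟ᵛ b
  ... | yes a≡b | _      = ⊥-elim (a≢b a≡b)
  ... | no _    | no b≢b = ⊥-elim (b≢b refl)
  ... | no _    | yes _  = sym (+≡0ℙ⇒≡ (trans (sym (parityℤ-+ (ℤ.- + 1) (net b R))) even))

  contraction-parity : ∀ {a b z x} R₁ R₂ → Reorientation (b , z) x →
    ∀ v → parityℤ (net v ((a , z) ∷ R₁ ++ R₂)) ≡ parityℤ (net v ((a , b) ∷ R₁ ++ x ∷ R₂))
  contraction-parity {a} {b} {z} R₁ R₂ bz~x v = trans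
    (cong parityℤ (sym (net-splice v R₁ R₂ (outflow-path v a b z))))
    (reorientation-parity v (keep ∷ Pointwise.++⁺ (Pointwise.refl keep {R₁}) (bz~x ∷ Pointwise.refl keep {R₂})))

  uncontract-balanced : ∀ {a b z x} R₁ R₂ {M′} → Reorientation (b , z) x →
    Pointwise Reorientation ((a , z) ∷ R₁ ++ R₂) M′ → (∀ v → net v M′ ≡ 0ℤ) →
    ∃[ M ] Pointwise Reorientation ((a , b) ∷ R₁ ++ x ∷ R₂) M × (∀ v → net v M ≡ 0ℤ)
  uncontract-balanced {b = b} R₁ R₂ bz~x (r ∷ rs) balanced′ with Pointwise-++⁻ R₁ rs | reorientation-subdivide b r
  ... | M₁ , M₂ , refl , R₁~M₁ , R₂~M₂ | y₁ , y₂ , ab~y₁ , bz~y₂ , path =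
    y₁ ∷ M₁ ++ y₂ ∷ M₂ ,
    ab~y₁ ∷ Pointwise.++⁺ R₁~M₁ (reorientation-trans (reorientation-sym bz~x) bz~y₂ ∷ R₂~M₂) ,
    λ v → trans (net-splice v M₁ M₂ (path v)) (balanced′ v)

  -- A non-loop (a , b) leaves b with odd degree in the rest, so there is an edge x between b and some z;
  -- the path a, b, z is contracted into the edge (a , z).
  balanced-reorientation : ∀ L → (∀ v → parityℤ (net v L) ≡ 0ℙ) →
                           ∃[ M ] Pointwise Reorientation L M × (∀ v → net v M ≡ 0ℤ)
  balanced-reorientation L = go L (<-wellFounded (length L))
    where
    go : ∀ L → Acc _<_ (length L) → (∀ v → parityℤ (net v L) ≡ 0ℙ) →
         ∃[ M ] Pointwise Reorientation L M × (∀ v → net v M ≡ 0ℤ)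
    go [] _ _ = [] , [] , λ _ → refl
    go ((a , b) ∷ R) (acc smaller) even with a ≟ᵛ b
    ... | yes refl =
      let M , R~M , balanced = go R (smaller ℕP.≤-refl) λ v → trans (cong parityℤ (sym (net-loop v a R))) (even v)
      in (a , a) ∷ M , keep ∷ R~M , λ v → trans (net-loop v a M) (balanced v)
    ... | no a≢b with odd-net⇒odd-edge b R (odd-net-after-edge {a} {b} {R} a≢b (even b))
    ... | R₁ , x , R₂ , refl , x-odd with odd-outflow⇒incident b x x-odd
    ... | z , bz~x =
      let _ , L′~M′ , balanced′ =
            go ((a , z) ∷ R₁ ++ R₂) (smaller (ℕP.≤-reflexive (cong suc (sym (length-++-sucʳ R₁ x R₂)))))
               (λ v → trans (contraction-parity R₁ R₂ bz~x v) (even v))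
      in uncontract-balanced R₁ R₂ bz~x L′~M′ balanced′

  net-tabulate : ∀ {k} v (F : Fin k → V × V) → net v (tabulate F) ≡ ℤΣ.sum (outflow v ∘ F)
  net-tabulate {zero}  v F = refl
  net-tabulate {suc k} v F = cong (ℤ._+_ (outflow v (F zero))) (net-tabulate v (F ∘ suc))

  reorientation-signs : ∀ {k} (F : Fin k → V × V) {M} → Pointwise Reorientation (tabulate F) M →
    Σ[ σ ∈ (Fin k → Sign) ] ∀ v → net v M ≡ ℤΣ.sum (λ e → (σ e ℤ.◃ 1) ℤ.* outflow v (F e))
  reorientation-signs {zero}  F []       = (λ ()) , λ _ → refl
  reorientation-signs {suc k} F (r ∷ rs) =
    let σ , net≡ = reorientation-signs (F ∘ suc) rs
    in sign r ∷ᵥ σ , λ v → cong₂ ℤ._+_ (outflow-reorient v r) (net≡ v)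

  balanced-signs : ∀ {k} (F : Fin k → V × V) → (∀ v → ℙΣ.sum (λ e → parityℤ (outflow v (F e))) ≡ 0ℙ) →
    Σ[ σ ∈ (Fin k → Sign) ] ∀ v → ℤΣ.sum (λ e → (σ e ℤ.◃ 1) ℤ.* outflow v (F e)) ≡ 0ℤ
  balanced-signs F even =
    let _ , F~M , balanced = balanced-reorientation (tabulate F) λ v →
          trans (cong parityℤ (net-tabulate v F)) (trans (foldr-homo parityℤ parityℤ-+ refl (outflow v ∘ F)) (even v))
        σ , net≡ = reorientation-signs F F~M
    in σ , λ v → trans (sym (net≡ v)) (balanced v)

fsum-difference : ∀ {k} (f g h : Fin k → ℤ) → (∀ i → f i ℤ.- g i ≡ h i) →
                  fsum ℤ._+_ 0ℤ f ℤ.- fsum ℤ._+_ 0ℤ g ≡ ℤΣ.sum h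
fsum-difference f g h f-g≡h = begin
  fsum ℤ._+_ 0ℤ f ℤ.- fsum ℤ._+_ 0ℤ g  ≡⟨ cong₂ ℤ._-_ (fsum≡foldr ℤ._+_ 0ℤ f) (fsum≡foldr ℤ._+_ 0ℤ g) ⟩
  ℤΣ.sum f ℤ.- ℤΣ.sum g                ≡⟨ cong (ℤ._+_ (ℤΣ.sum f)) (foldr-homo ℤ.-_ ℤP.neg-distrib-+ refl g) ⟩
  ℤΣ.sum f ℤ.+ ℤΣ.sum (ℤ.-_ ∘ g)       ≡⟨ ℤΣ.∑-distrib-+ f (ℤ.-_ ∘ g) ⟨
  ℤΣ.sum (λ i → f i ℤ.- g i)           ≡⟨ ℤΣ.sum-cong-≗ f-g≡h ⟩
  ℤΣ.sum h                             ∎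
  where open ≡-Reasoning

module _ (G : Graph) (o : Orientation G) where
  open Graph G

  incidence : Fin n → Fin m → ℤ
  incidence v e = outflow _≟_ v (tail G o e , head G o e)

  -- The summands of Defs.sumOut and Defs.sumIn are where-bound and cannot be named, so the type of
  -- this pointwise lemma is left to unification (hence its signature precedes its use).
  flow-term : (v : Fin n) (ψ : Fin m → ℤ) (e : Fin m) → _

  net-outflow : ∀ v ψ → sumOut G o ℤ._+_ 0ℤ v ψ ℤ.- sumIn G o ℤ._+_ 0ℤ v ψ ≡ ℤΣ.sum (λ e → ψ e ℤ.* incidence v e)
  net-outflow v ψ = fsum-difference _ _ (λ e → ψ e ℤ.* incidence v e) (flow-term v ψ)

  flow-term v ψ e with tail G o e ≟ v | head G o e ≟ v
  ... | yes _ | yes _ = sym (ℤP.*-zeroʳ (ψ e))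
  ... | yes _ | no _  = trans (ℤP.+-identityʳ (ψ e)) (sym (ℤP.*-identityʳ (ψ e)))
  ... | no _  | yes _ = trans (ℤP.+-identityˡ (ℤ.- ψ e)) (trans (sym (ℤP.-1*i≡-i (ψ e))) (ℤP.*-comm ℤ.-1ℤ (ψ e)))
  ... | no _  | no _  = sym (ℤP.*-zeroʳ (ψ e))

  Balanced : (Fin m → ℤ) → Set
  Balanced ψ = ∀ v → ℤΣ.sum (λ e → ψ e ℤ.* incidence v e) ≡ 0ℤ

  balanced⇒conserved : ∀ {ψ} → Balanced ψ → ∀ v → sumOut G o ℤ._+_ 0ℤ v ψ ≡ sumIn G o ℤ._+_ 0ℤ v ψ
  balanced⇒conserved {ψ} balanced v = ℤP.i-j≡0⇒i≡j _ _ (trans (net-outflow v ψ) (balanced v))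

  balanced-+-2* : ∀ {A B} → Balanced A → Balanced B → Balanced (λ e → A e ℤ.+ + 2 ℤ.* B e)
  balanced-+-2* {A} {B} A-balanced B-balanced v = begin
    ℤΣ.sum (λ e → (A e ℤ.+ + 2 ℤ.* B e) ℤ.* incidence v e)
      ≡⟨ ℤΣ.sum-cong-≗ (λ e → solve 3 (λ a b x → (a :+ con (+ 2) :* b) :* x := a :* x :+ con (+ 2) :* (b :* x))
                                      refl (A e) (B e) (incidence v e)) ⟩
    ℤΣ.sum (λ e → A e ℤ.* incidence v e ℤ.+ + 2 ℤ.* (B e ℤ.* incidence v e))
      ≡⟨ ℤΣ.∑-distrib-+ (λ e → A e ℤ.* incidence v e) (λ e → + 2 ℤ.* (B e ℤ.* incidence v e)) ⟩
    ℤΣ.sum (λ e → A e ℤ.* incidence v e) ℤ.+ ℤΣ.sum (λ e → + 2 ℤ.* (B e ℤ.* incidence v e))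
      ≡⟨ cong (ℤ._+_ (ℤΣ.sum (λ e → A e ℤ.* incidence v e))) (ℤΣ.*-distribˡ-sum (+ 2) (λ e → B e ℤ.* incidence v e)) ⟨
    ℤΣ.sum (λ e → A e ℤ.* incidence v e) ℤ.+ + 2 ℤ.* ℤΣ.sum (λ e → B e ℤ.* incidence v e)
      ≡⟨ cong₂ (λ s t → s ℤ.+ + 2 ℤ.* t) (A-balanced v) (B-balanced v) ⟩
    0ℤ ∎
    where open ≡-Reasoning
          open ℤ-Solver

  IsEven : (Fin m → Parity) → Set
  IsEven S = ∀ v → ℙΣ.sum (λ e → parityℤ (incidence v e) ℙ.* S e) ≡ 0ℙ

  private
    -- Edges outside the subgraph become loops, which contribute to no outflow.
    subgraph-edge : Parity → Fin m → Fin n × Fin n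
    subgraph-edge 0ℙ e = tail G o e , tail G o e
    subgraph-edge 1ℙ e = tail G o e , head G o e

  even-subgraph-flow : ∀ S → IsEven S → Σ[ σ ∈ (Fin m → Sign) ] Balanced (λ e → σ e ℤ.◃ toℕ (S e))
  even-subgraph-flow S even =
    let σ , balanced = balanced-signs _≟_ F (λ v → trans (ℙΣ.sum-cong-≗ (parity-F v)) (even v))
    in σ , λ v → trans (ℤΣ.sum-cong-≗ (signed-F v σ)) (balanced v)
    where
    F : Fin m → Fin n × Fin n
    F e = subgraph-edge (S e) e
    parity-F : ∀ v e → parityℤ (outflow _≟_ v (F e)) ≡ parityℤ (incidence v e) ℙ.* S e
    parity-F v e with S e
    ... | 0ℙ = trans (cong parityℤ (outflow-loop _≟_ v (tail G o e))) (sym (ℙP.*-zeroʳ _))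
    ... | 1ℙ = sym (ℙP.*-identityʳ _)
    signed-F : ∀ v (σ : Fin m → Sign) e →
               (σ e ℤ.◃ toℕ (S e)) ℤ.* incidence v e ≡ (σ e ℤ.◃ 1) ℤ.* outflow _≟_ v (F e)
    signed-F v σ e with S e
    ... | 0ℙ = sym (trans (cong ((σ e ℤ.◃ 1) ℤ.*_) (outflow-loop _≟_ v (tail G o e))) (ℤP.*-zeroʳ (σ e ℤ.◃ 1)))
    ... | 1ℙ = refl

  four-flow : ∀ (p q : Fin m → Parity) → (∀ e → (p e , q e) ≢ 0²) → IsEven p → IsEven q → Admits4Flow G
  four-flow p q covered p-even q-even =
    let σ , σ-balanced = even-subgraph-flow p p-even
        τ , τ-balanced = even-subgraph-flow q q-even
    in o , (λ e → (σ e ℤ.◃ toℕ (p e)) ℤ.+ + 2 ℤ.* (τ e ℤ.◃ toℕ (q e))) ,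
       (λ e → bounded (σ e) (τ e) (covered e)) ,
       balanced⇒conserved (balanced-+-2* {A = λ e → σ e ℤ.◃ toℕ (p e)} σ-balanced τ-balanced)
    where
    bounded : ∀ s t {x y} → (x , y) ≢ 0² →
              (1 ℕ.≤ ℤ.∣ (s ℤ.◃ toℕ x) ℤ.+ + 2 ℤ.* (t ℤ.◃ toℕ y) ∣) ×
              (ℤ.∣ (s ℤ.◃ toℕ x) ℤ.+ + 2 ℤ.* (t ℤ.◃ toℕ y) ∣ ℕ.≤ 3)
    bounded _      _      {0ℙ} {0ℙ} xy≢0 = ⊥-elim (xy≢0 refl)
    bounded Sign.+ _      {1ℙ} {0ℙ} _ = ℕP.≤-refl , ℕ.s≤s ℕ.z≤n
    bounded Sign.- _      {1ℙ} {0ℙ} _ = ℕP.≤-refl , ℕ.s≤s ℕ.z≤n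
    bounded _      Sign.+ {0ℙ} {1ℙ} _ = ℕ.s≤s ℕ.z≤n , ℕ.s≤s (ℕ.s≤s ℕ.z≤n)
    bounded _      Sign.- {0ℙ} {1ℙ} _ = ℕ.s≤s ℕ.z≤n , ℕ.s≤s (ℕ.s≤s ℕ.z≤n)
    bounded Sign.+ Sign.+ {1ℙ} {1ℙ} _ = ℕ.s≤s ℕ.z≤n , ℕP.≤-refl
    bounded Sign.+ Sign.- {1ℙ} {1ℙ} _ = ℕP.≤-refl , ℕ.s≤s ℕ.z≤n
    bounded Sign.- Sign.+ {1ℙ} {1ℙ} _ = ℕP.≤-refl , ℕ.s≤s ℕ.z≤n
    bounded Sign.- Sign.- {1ℙ} {1ℙ} _ = ℕ.s≤s ℕ.z≤n , ℕP.≤-refl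

∑-over-classes : ∀ {m b} (c : Fin m → Fin b) (N : Fin m → Parity) (p : Fin b → Parity) →
  ℙΣ.sum (λ i → ℙΣ.sum (λ e → 𝟙 (c e ≟ i) ℙ.* N e) ℙ.* p i) ≡ ℙΣ.sum (λ e → N e ℙ.* p (c e))
∑-over-classes c N p = begin
  ℙΣ.sum (λ i → ℙΣ.sum (λ e → 𝟙 (c e ≟ i) ℙ.* N e) ℙ.* p i)
    ≡⟨ ℙΣ.sum-cong-≗ (λ i → ℙΣ.*-distribʳ-sum (p i) (λ e → 𝟙 (c e ≟ i) ℙ.* N e)) ⟩
  ℙΣ.sum (λ i → ℙΣ.sum (λ e → 𝟙 (c e ≟ i) ℙ.* N e ℙ.* p i))
    ≡⟨ ℙΣ.∑-comm (λ i e → 𝟙 (c e ≟ i) ℙ.* N e ℙ.* p i) ⟩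
  ℙΣ.sum (λ e → ℙΣ.sum (λ i → 𝟙 (c e ≟ i) ℙ.* N e ℙ.* p i))
    ≡⟨ ℙΣ.sum-cong-≗ (λ e → trans (ℙΣ.sum-cong-≗ (λ i → reorder (𝟙 (c e ≟ i)) (N e) (p i)))
                                  (sym (ℙΣ.*-distribˡ-sum (N e) (λ i → 𝟙 (c e ≟ i) ℙ.* p i)))) ⟩
  ℙΣ.sum (λ e → N e ℙ.* ℙΣ.sum (λ i → 𝟙 (c e ≟ i) ℙ.* p i))
    ≡⟨ ℙΣ.sum-cong-≗ (λ e → cong (N e ℙ.*_) (select e)) ⟩
  ℙΣ.sum (λ e → N e ℙ.* p (c e)) ∎
  where
  open ≡-Reasoning
  reorder : ∀ x y z → x ℙ.* y ℙ.* z ≡ y ℙ.* (x ℙ.* z)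
  reorder = solve 3 (λ x y z → x :* y :* z := y :* (x :* z)) refl
    where open ℙ-Solver
  select : ∀ e → ℙΣ.sum (λ i → 𝟙 (c e ≟ i) ℙ.* p i) ≡ p (c e)
  select e = trans (sum-δ ℙP.+-0-commutativeMonoid (λ i → 𝟙 (c e ≟ i) ℙ.* p i) (c e) off-diagonal) diagonal
    where
    off-diagonal : ∀ i → i ≢ c e → 𝟙 (c e ≟ i) ℙ.* p i ≡ 0ℙ
    off-diagonal i i≢ce with c e ≟ i
    ... | yes ce≡i = ⊥-elim (i≢ce (sym ce≡i))
    ... | no _     = refl
    diagonal : 𝟙 (c e ≟ c e) ℙ.* p (c e) ≡ p (c e)
    diagonal with c e ≟ c e
    ... | yes _    = refl
    ... | no ce≢ce = ⊥-elim (ce≢ce refl)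

module _ (G : Graph) (o : Orientation G) {b : ℕ} (cls : Fin (Graph.m G) → Fin b) where
  open Graph G

  parity-indicator : ∀ i e → parityℤ (indicator G o cls i e) ≡ 𝟙 (cls e ≟ i)
  parity-indicator i e with cls e ≟ i
  ... | yes _ = refl
  ... | no _  = refl

  parity-ε : ∀ v i → parityℤ (ε G o cls v i) ≡ ℙΣ.sum (λ e → 𝟙 (cls e ≟ i) ℙ.* parityℤ (incidence G o v e))
  parity-ε v i = begin
    parityℤ (ε G o cls v i)
      ≡⟨ cong parityℤ (net-outflow G o v (indicator G o cls i)) ⟩
    parityℤ (ℤΣ.sum (λ e → indicator G o cls i e ℤ.* incidence G o v e))
      ≡⟨ foldr-homo parityℤ parityℤ-+ refl (λ e → indicator G o cls i e ℤ.* incidence G o v e) ⟩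
    ℙΣ.sum (λ e → parityℤ (indicator G o cls i e ℤ.* incidence G o v e))
      ≡⟨ ℙΣ.sum-cong-≗ (λ e → trans (parityℤ-* (indicator G o cls i e) (incidence G o v e))
                                    (cong (ℙ._* parityℤ (incidence G o v e)) (parity-indicator i e))) ⟩
    ℙΣ.sum (λ e → 𝟙 (cls e ≟ i) ℙ.* parityℤ (incidence G o v e)) ∎
    where open ≡-Reasoning

  orthogonal⇒even : ∀ p → (∀ v → (parityℤ ∘ ε G o cls v) · p ≡ 0ℙ) → IsEven G o (p ∘ cls)
  orthogonal⇒even p ε⊥p v = begin
    ℙΣ.sum (λ e → parityℤ (incidence G o v e) ℙ.* p (cls e))
      ≡⟨ ∑-over-classes cls (parityℤ ∘ incidence G o v) p ⟨
    ℙΣ.sum (λ i → ℙΣ.sum (λ e → 𝟙 (cls e ≟ i) ℙ.* parityℤ (incidence G o v e)) ℙ.* p i)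
      ≡⟨ ℙΣ.sum-cong-≗ (λ i → cong (ℙ._* p i) (sym (parity-ε v i))) ⟩
    (parityℤ ∘ ε G o cls v) · p
      ≡⟨ ε⊥p v ⟩
    0ℙ ∎
    where open ≡-Reasoning

  InSℤ : (Fin b → ℤ) → Set
  InSℤ y = InS G o cls (fromℤ ∘ y)

  0∈S : InSℤ (λ _ → 0ℤ)
  0∈S = (λ _ → 0ℚ) , λ i → sym (begin
    fsum ℚ._+_ 0ℚ (λ v → 0ℚ ℚ.* fromℤ (ε G o cls v i))  ≡⟨ fsum≡foldr ℚ._+_ 0ℚ (λ v → 0ℚ ℚ.* fromℤ (ε G o cls v i)) ⟩
    ℚΣ.sum (λ v → 0ℚ ℚ.* fromℤ (ε G o cls v i))         ≡⟨ ℚΣ.sum-cong-≗ (λ v → ℚP.*-zeroˡ (fromℤ (ε G o cls v i))) ⟩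
    ℚΣ.sum {n} (λ _ → 0ℚ)                              ≡⟨ ℚΣ.sum-replicate-zero n ⟩
    0ℚ                                                 ∎)
    where open ≡-Reasoning

  ε∈S : ∀ v → InSℤ (ε G o cls v)
  ε∈S v = δ , λ i → sym (begin
    fsum ℚ._+_ 0ℚ (λ u → δ u ℚ.* E u i)  ≡⟨ fsum≡foldr ℚ._+_ 0ℚ (λ u → δ u ℚ.* E u i) ⟩
    ℚΣ.sum (λ u → δ u ℚ.* E u i)         ≡⟨ sum-δ ℚP.+-0-commutativeMonoid (λ u → δ u ℚ.* E u i) v
                                              (λ u u≢v → off-diagonal u u≢v i) ⟩
    δ v ℚ.* E v i                       ≡⟨ diagonal i ⟩
    E v i                               ∎)
    where
    open ≡-Reasoning
    E : Fin n → Fin b → ℚ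
    E u i = fromℤ (ε G o cls u i)
    δ : Fin n → ℚ
    δ u with u ≟ v
    ... | yes _ = 1ℚ
    ... | no _  = 0ℚ
    off-diagonal : ∀ u → u ≢ v → ∀ i → δ u ℚ.* E u i ≡ 0ℚ
    off-diagonal u u≢v i with u ≟ v
    ... | yes u≡v = ⊥-elim (u≢v u≡v)
    ... | no _    = ℚP.*-zeroˡ (E u i)
    diagonal : ∀ i → δ v ℚ.* E v i ≡ E v i
    diagonal i with v ≟ v
    ... | yes _  = ℚP.*-identityˡ (E v i)
    ... | no v≢v = ⊥-elim (v≢v refl)

  +∈S : ∀ y y′ → InSℤ y → InSℤ y′ → InSℤ (λ i → y i ℤ.+ y′ i)
  +∈S y y′ (q , y≡) (q′ , y′≡) = (λ v → q v ℚ.+ q′ v) , λ i → begin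
    fromℤ (y i ℤ.+ y′ i)
      ≡⟨ fromℤ-+ (y i) (y′ i) ⟩
    fromℤ (y i) ℚ.+ fromℤ (y′ i)
      ≡⟨ cong₂ ℚ._+_ (trans (y≡ i) (fsum≡foldr ℚ._+_ 0ℚ (λ v → q v ℚ.* E v i)))
                     (trans (y′≡ i) (fsum≡foldr ℚ._+_ 0ℚ (λ v → q′ v ℚ.* E v i))) ⟩
    ℚΣ.sum (λ v → q v ℚ.* E v i) ℚ.+ ℚΣ.sum (λ v → q′ v ℚ.* E v i)
      ≡⟨ ℚΣ.∑-distrib-+ (λ v → q v ℚ.* E v i) (λ v → q′ v ℚ.* E v i) ⟨
    ℚΣ.sum (λ v → q v ℚ.* E v i ℚ.+ q′ v ℚ.* E v i)
      ≡⟨ ℚΣ.sum-cong-≗ (λ v → ℚP.*-distribʳ-+ (E v i) (q v) (q′ v)) ⟨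
    ℚΣ.sum (λ v → (q v ℚ.+ q′ v) ℚ.* E v i)
      ≡⟨ fsum≡foldr ℚ._+_ 0ℚ (λ v → (q v ℚ.+ q′ v) ℚ.* E v i) ⟨
    fsum ℚ._+_ 0ℚ (λ v → (q v ℚ.+ q′ v) ℚ.* E v i) ∎
    where
    open ≡-Reasoning
    E : Fin n → Fin b → ℚ
    E v i = fromℤ (ε G o cls v i)

  parities-dependent-in-S : RankAtMost2 G o cls → ∀ y₁ y₂ y₃ → InSℤ y₁ → InSℤ y₂ → InSℤ y₃ →
                            Dependent (parityℤ ∘ y₁) (parityℤ ∘ y₂) (parityℤ ∘ y₃)
  parities-dependent-in-S (_ , _ , in-plane) y₁ y₂ y₃ y₁∈S y₂∈S y₃∈S =
    parities-dependent y₁ y₂ y₃ (in-plane _ y₁∈S) (in-plane _ y₂∈S) (in-plane _ y₃∈S)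

  odd-coordinate-free⇒non-unit : OddCoordinateFree G o cls → ∀ y → InSℤ y → ¬ IsUnitVector (parityℤ ∘ y)
  odd-coordinate-free⇒non-unit odd-free y y∈S (i , yᵢ-odd , others-even) =
    odd-free y y∈S (i , (λ 2∣yᵢ → 1ℙ≢0ℙ (trans (sym yᵢ-odd) (2∣⇒parity≡0ℙ 2∣yᵢ))) ,
                        λ j j≢i → parity≡0ℙ⇒2∣ ℤ.∣ y j ∣ (others-even j j≢i))
    where 1ℙ≢0ℙ : 1ℙ ≢ 0ℙ
          1ℙ≢0ℙ ()

theorem1p7 : (ℝ : RealField) (G : Graph) (o : Orientation G)
    (φ : Fin (Graph.m G) → R³ ℝ) → IsS2Flow ℝ G o φ →
    (en : ValueEnumeration ℝ G φ) →
    OddCoordinateFree G o (ValueEnumeration.cls en) →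
    RankAtMost2 G o (ValueEnumeration.cls en) →
    Admits4Flow G
theorem1p7 ℝ G o φ _ en odd-free rank≤2 =
  let open ValueEnumeration en
      non-unit = odd-coordinate-free⇒non-unit G o cls odd-free
      a , b , a∈S , b∈S , ε∈span =
        spanned-by-two (parityℤ ∘_) (InSℤ G o cls) (λ _ → 0ℤ) (0∈S G o cls)
          (parities-dependent-in-S G o cls rank≤2) (ε G o cls) (ε∈S G o cls)
      p , q , covered , (a⊥p , b⊥p) , (a⊥q , b⊥q) =
        orthogonal-cover (parityℤ ∘ a) (parityℤ ∘ b) (non-unit a a∈S) (non-unit b b∈S)
          (non-unit (λ i → a i ℤ.+ b i) (+∈S G o cls a b a∈S b∈S) ∘ IsUnitVector-resp (λ i → sym (parityℤ-+ (a i) (b i))))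
  in four-flow G o (p ∘ cls) (q ∘ cls) (covered ∘ cls)
       (orthogonal⇒even G o cls p (λ v → InSpan-orthogonal a⊥p b⊥p (ε∈span v)))
       (orthogonal⇒even G o cls q (λ v → InSpan-orthogonal a⊥q b⊥q (ε∈span v)))
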